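{- Let $n$ be an odd composite integer. Then $|S(n)| = 2$ if and only if (1) $n$ is divisible by some prime $p \equiv 3 \pmod 4$, and (2) $\gcd(p', (n/p)') = 1$ for every prime $p$ dividing $n$.
   Context: For a positive integer $m$, $m'$ denotes the odd part of $m-1$, i.e. $m - 1 = 2^k m'$ with $m'$ odd (for $m=1$ this convention is applied formally). For $n$ with $n-1 = 2^k n'$, $n'$ odd, define $S(n) = \{ a \bmod n : a^{n'} \equiv 1 \pmod n \text{ or } a^{2^i n'} \equiv -1 \pmod n \text{ for some } 0 \le i < k\}$ (the set of strong liars). -}

module Defs where

open import Data.Nat.Base using (ℕ; zero; suc; _∸_; _^_; _*_; _<_; _%_; _≡ᵇ_; ⌊_/2⌋)
open import Data.Bool.Base using (if_then_else_)
open import Data.Fin.Base using (Fin; toℕ)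
open import Data.Integer.Base using (ℤ; +_; _-_; -_; 1ℤ)
open import Data.Integer.Divisibility using (_∣_)
open import Data.Product using (Σ; _×_; ∃)
open import Data.Sum using (_⊎_)
open import Relation.Binary.PropositionalEquality using (_≡_; _≢_)

oddPartAux : ℕ → ℕ → ℕ
oddPartAux zero    m       = m
oddPartAux (suc f) zero    = zero
oddPartAux (suc f) (suc m) =
  if (suc m % 2) ≡ᵇ 0 then oddPartAux f ⌊ suc m /2⌋ else suc m

-- 2-adic valuation with fuel (val of 0 is 0 by convention; irrelevant here).
val2Aux : ℕ → ℕ → ℕ
val2Aux zero    m       = zero
val2Aux (suc f) zero    = zero
val2Aux (suc f) (suc m) =
  if (suc m % 2) ≡ᵇ 0 then suc (val2Aux f ⌊ suc m /2⌋) else zero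

-- odd part of m (for m ≥ 1, m = 2^(val2 m) * oddPart m with oddPart m odd)
oddPart : ℕ → ℕ
oddPart m = oddPartAux m m

val2 : ℕ → ℕ
val2 m = val2Aux m m

-- m' := odd part of m - 1
dash : ℕ → ℕ
dash m = oddPart (m ∸ 1)

_≡_[mod_] : ℤ → ℤ → ℕ → Set
infix 4 _≡_[mod_]
x ≡ y [mod n ] = (+ n) ∣ (x - y)

StrongLiar : (n : ℕ) → ℕ → Set
StrongLiar n a =
  (+ (a ^ dash n) ≡ 1ℤ [mod n ])
  ⊎ (Σ ℕ λ i → i < val2 (n ∸ 1) × (+ (a ^ (2 ^ i * dash n)) ≡ - 1ℤ [mod n ]))

S : (n : ℕ) → Fin n → Set
S n a = StrongLiar n (toℕ a)

HasExactlyTwo : {A : Set} → (A → Set) → Set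
HasExactlyTwo {A} P =
  Σ A λ a → Σ A λ b → a ≢ b × P a × P b × ((c : A) → P c → c ≡ a ⊎ c ≡ b)

module Submission where

-- The residues ±1 are always strong liars.  For (⇐), condition (2) makes n'
-- coprime to p - 1 for every prime p ∣ n; so a ^ n' ≡ 1 forces a ≡ 1 modulo p
-- (Fermat and Bézout) and then modulo every prime power p ^ k ∣ n (lifting,
-- using p ∤ n'), i.e. modulo n.  Thus a ^ n' ≡ ±1 gives a ≡ ±1, while
-- a ^ (2 ^ i n') ≡ -1 with i ≥ 1 would make a ^ (2 ^ (i - 1) n') a square root
-- of -1 modulo a prime ≡ 3 (mod 4).  For (⇒) a third liar is built by the
-- Chinese remainder theorem: if (2) fails, from an element of prime order
-- r ∣ gcd(p', q') modulo the p-part of n; if (1) fails, from a square root of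
-- -1 modulo n, which exists as every prime factor is ≡ 1 (mod 4).

module Congruences where
  open import Data.Nat.Base as ℕ using (ℕ; zero; suc; _≤_; _<_)
  import Data.Nat.Properties as ℕP
  open import Data.Nat.Divisibility as ℕD using (divides)
  open import Data.Nat.Coprimality as Coprimality using (Coprime; coprime-divisor; coprime-Bézout)
  open import Data.Nat.GCD using (module Bézout)
  open import Data.Integer.Base using (ℤ; +_; -_; _+_; _-_; _*_; _^_; 0ℤ; 1ℤ; -1ℤ; ∣_∣)
  import Data.Integer.Properties as ℤP
  open import Data.Integer.DivMod using (_%ℕ_; _/ℕ_; n%ℕd<d; a≡a%ℕn+[a/ℕn]*n)
  open import Data.Integer.Divisibility.Signed as ℤD using (divides) renaming (_∣_ to _∣ℤ_)
  open import Data.Integer.Tactic.RingSolver using (solve-∀)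
  open import Data.Sum using (inj₁; inj₂)
  open import Data.Product using (Σ; _,_; _×_)
  open import Relation.Nullary using (¬_; Dec; contradiction)
  open import Relation.Nullary.Decidable using (map′)
  open import Relation.Binary.PropositionalEquality
  open import Relation.Binary.Bundles using (Setoid)
  import Relation.Binary.Reasoning.Setoid as SetoidReasoning
  open import Level using (0ℓ)
  open import Defs using (_≡_[mod_])

  -- Congruence of integers modulo a natural number, as a record so that
  -- both sides can be inferred; the field is signed divisibility of the
  -- difference, which has the convenient ring-theoretic API.
  infix 4 _≡_⟨mod_⟩
  record _≡_⟨mod_⟩ (x y : ℤ) (n : ℕ) : Set where
    constructor mkCong
    field divides-difference : + n ∣ℤ (x - y)
  open _≡_⟨mod_⟩ public

  toStatementCong : ∀ {n x y} → x ≡ y ⟨mod n ⟩ → x ≡ y [mod n ]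
  toStatementCong (mkCong d) = ℤD.∣⇒∣ᵤ d

  fromStatementCong : ∀ {n x y} → x ≡ y [mod n ] → x ≡ y ⟨mod n ⟩
  fromStatementCong d = mkCong (ℤD.∣ᵤ⇒∣ d)

  ∣ℤ⇒∣ : ∀ {p x} → + p ∣ℤ x → p ℕD.∣ ∣ x ∣
  ∣ℤ⇒∣ = ℤD.∣⇒∣ᵤ

  ∣⇒∣ℤ : ∀ {p x} → p ℕD.∣ ∣ x ∣ → + p ∣ℤ x
  ∣⇒∣ℤ = ℤD.∣ᵤ⇒∣

  module _ {n : ℕ} where

    private
      _by_ : ∀ {a b} → + n ∣ℤ a → a ≡ b → + n ∣ℤ b
      d by eq = subst (+ n ∣ℤ_) eq d
      infixl 5 _by_

      n∣0 : + n ∣ℤ 0ℤ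
      n∣0 = divides 0ℤ (sym (ℤP.*-zeroˡ (+ n)))

    ≡-mod-refl : ∀ x → x ≡ x ⟨mod n ⟩
    ≡-mod-refl x = mkCong (n∣0 by sym (ℤP.+-inverseʳ x))

    ≡-mod-reflexive : ∀ {x y} → x ≡ y → x ≡ y ⟨mod n ⟩
    ≡-mod-reflexive {x} refl = ≡-mod-refl x

    ≡-mod-sym : ∀ {x y} → x ≡ y ⟨mod n ⟩ → y ≡ x ⟨mod n ⟩
    ≡-mod-sym {x} {y} (mkCong d) = mkCong (ℤD.∣m⇒∣-m d by identity x y)
      where
      identity : ∀ x y → - (x - y) ≡ y - x
      identity = solve-∀

    ≡-mod-trans : ∀ {x y z} → x ≡ y ⟨mod n ⟩ → y ≡ z ⟨mod n ⟩ → x ≡ z ⟨mod n ⟩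
    ≡-mod-trans {x} {y} {z} (mkCong d) (mkCong e) = mkCong (ℤD.∣m∣n⇒∣m+n d e by identity x y z)
      where
      identity : ∀ x y z → (x - y) + (y - z) ≡ x - z
      identity = solve-∀

    +-cong-mod : ∀ {x x' y y'} → x ≡ x' ⟨mod n ⟩ → y ≡ y' ⟨mod n ⟩ → x + y ≡ x' + y' ⟨mod n ⟩
    +-cong-mod {x} {x'} {y} {y'} (mkCong d) (mkCong e) =
      mkCong (ℤD.∣m∣n⇒∣m+n d e by identity x x' y y')
      where
      identity : ∀ x x' y y' → (x - x') + (y - y') ≡ (x + y) - (x' + y')
      identity = solve-∀

    *-cong-mod : ∀ {x x' y y'} → x ≡ x' ⟨mod n ⟩ → y ≡ y' ⟨mod n ⟩ → x * y ≡ x' * y' ⟨mod n ⟩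
    *-cong-mod {x} {x'} {y} {y'} (mkCong d) (mkCong e) =
      mkCong (ℤD.∣m∣n⇒∣m+n (ℤD.∣m⇒∣m*n y d) (ℤD.∣n⇒∣m*n x' e) by identity x x' y y')
      where
      identity : ∀ x x' y y' → (x - x') * y + x' * (y - y') ≡ x * y - x' * y'
      identity = solve-∀

    neg-cong-mod : ∀ {x y} → x ≡ y ⟨mod n ⟩ → - x ≡ - y ⟨mod n ⟩
    neg-cong-mod {x} {y} (mkCong d) = mkCong (ℤD.∣m⇒∣-m d by identity x y)
      where
      identity : ∀ x y → - (x - y) ≡ - x - - y
      identity = solve-∀

    ^-cong-mod : ∀ {x y} k → x ≡ y ⟨mod n ⟩ → x ^ k ≡ y ^ k ⟨mod n ⟩
    ^-cong-mod zero    _ = ≡-mod-refl 1ℤ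
    ^-cong-mod (suc k) e = *-cong-mod e (^-cong-mod k e)

    ∣⇒≡0-mod : ∀ {x} → + n ∣ℤ x → x ≡ 0ℤ ⟨mod n ⟩
    ∣⇒≡0-mod {x} d = mkCong (d by sym (ℤP.+-identityʳ x))

    ≡0-mod⇒∣ : ∀ {x} → x ≡ 0ℤ ⟨mod n ⟩ → + n ∣ℤ x
    ≡0-mod⇒∣ {x} (mkCong d) = d by ℤP.+-identityʳ x

  ≡-mod-setoid : ℕ → Setoid 0ℓ 0ℓ
  ≡-mod-setoid n = record
    { Carrier       = ℤ
    ; _≈_           = _≡_⟨mod n ⟩
    ; isEquivalence = record { refl = λ {x} → ≡-mod-refl x ; sym = ≡-mod-sym ; trans = ≡-mod-trans }
    }

  module ≡-mod-Reasoning (n : ℕ) = SetoidReasoning (≡-mod-setoid n)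

  ≡-mod-1 : ∀ x y → x ≡ y ⟨mod 1 ⟩
  ≡-mod-1 x y = mkCong (divides (x - y) (sym (ℤP.*-identityʳ (x - y))))

  ≡-mod-divisor : ∀ {d n x y} → d ℕD.∣ n → x ≡ y ⟨mod n ⟩ → x ≡ y ⟨mod d ⟩
  ≡-mod-divisor d∣n (mkCong e) = mkCong (ℤD.∣-trans (∣⇒∣ℤ d∣n) e)

  coprime-∣-product : ∀ {A B m} → Coprime A B → A ℕD.∣ m → B ℕD.∣ m → A ℕ.* B ℕD.∣ m
  coprime-∣-product {A} {B} coprime (divides k m≡kA) B∣m =
    subst₂ ℕD._∣_ (ℕP.*-comm B A) (sym m≡kA) (ℕD.*-monoˡ-∣ A B∣k)
    where
    B∣k : B ℕD.∣ k
    B∣k = coprime-divisor (Coprimality.sym coprime) (subst (B ℕD.∣_) (trans m≡kA (ℕP.*-comm k A)) B∣m)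

  ≡-mod-combine : ∀ {A B x y} → Coprime A B →
                  x ≡ y ⟨mod A ⟩ → x ≡ y ⟨mod B ⟩ → x ≡ y ⟨mod A ℕ.* B ⟩
  ≡-mod-combine coprime (mkCong a) (mkCong b) =
    mkCong (∣⇒∣ℤ (coprime-∣-product coprime (∣ℤ⇒∣ a) (∣ℤ⇒∣ b)))

  reduce : ∀ (x : ℤ) N .{{_ : ℕ.NonZero N}} → Σ ℕ λ r → r < N × + r ≡ x ⟨mod N ⟩
  reduce x N = x %ℕ N , n%ℕd<d x N , mkCong (divides (- (x /ℕ N)) remainder-difference)
    where
    identity : ∀ r q n → r - (r + q * n) ≡ - q * n
    identity = solve-∀
    remainder-difference : + (x %ℕ N) - x ≡ - (x /ℕ N) * + N
    remainder-difference = trans (cong (λ z → + (x %ℕ N) - z) (a≡a%ℕn+[a/ℕn]*n x N))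
                                 (identity (+ (x %ℕ N)) (x /ℕ N) (+ N))

  multiple-below⇒0 : ∀ {n k} → n ℕD.∣ k → k < n → k ≡ 0
  multiple-below⇒0 {k = zero}  _   _   = refl
  multiple-below⇒0 {k = suc k} n∣k k<n = contradiction n∣k (ℕD.>⇒∤ k<n)

  private
    residue-unique-≤ : ∀ {n a b} → a < n → b ≤ a → + a ≡ + b ⟨mod n ⟩ → a ≡ b
    residue-unique-≤ {n} {a} {b} a<n b≤a (mkCong d) = ℕP.≤-antisym (ℕP.m∸n≡0⇒m≤n a∸b≡0) b≤a
      where
      ∣a-b∣ : ∣ + a - + b ∣ ≡ a ℕ.∸ b
      ∣a-b∣ = cong ∣_∣ (trans (ℤP.m-n≡m⊖n a b) (ℤP.⊖-≥ b≤a))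
      a∸b≡0 : a ℕ.∸ b ≡ 0
      a∸b≡0 = multiple-below⇒0 (subst (n ℕD.∣_) ∣a-b∣ (∣ℤ⇒∣ d)) (ℕP.≤-<-trans (ℕP.m∸n≤m a b) a<n)

  residue-unique : ∀ {n a b} → a < n → b < n → + a ≡ + b ⟨mod n ⟩ → a ≡ b
  residue-unique a<n b<n a≡b with ℕP.≤-total _ _
  ... | inj₁ a≤b = sym (residue-unique-≤ b<n a≤b (≡-mod-sym a≡b))
  ... | inj₂ b≤a = residue-unique-≤ a<n b≤a a≡b

  1≢-1-mod : ∀ {n} → 2 < n → ¬ (1ℤ ≡ -1ℤ ⟨mod n ⟩)
  1≢-1-mod 2<n (mkCong d) = ℕP.<⇒≱ 2<n (ℕD.∣⇒≤ (∣ℤ⇒∣ d))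

  multiple≡0-mod : ∀ k M → + (k ℕ.* M) ≡ 0ℤ ⟨mod M ⟩
  multiple≡0-mod k M = ∣⇒≡0-mod (∣⇒∣ℤ (ℕD.n∣m*n k))

  -- The solution is u + (v - u) e for an integer
  -- e ≡ 0 (mod A), e ≡ 1 (mod B), which Bézout's identity provides.
  separating-element : ∀ {A B} → Coprime A B → Σ ℤ λ e → e ≡ 0ℤ ⟨mod A ⟩ × e ≡ 1ℤ ⟨mod B ⟩
  separating-element {A} {B} coprime with coprime-Bézout coprime
  ... | Bézout.+- x y 1+yB≡xA = + (x ℕ.* A) , multiple≡0-mod x A , xA≡1
    where
    xA≡1 : + (x ℕ.* A) ≡ 1ℤ ⟨mod B ⟩
    xA≡1 = subst (λ z → + z ≡ 1ℤ ⟨mod B ⟩) 1+yB≡xA (+-cong-mod (≡-mod-refl 1ℤ) (multiple≡0-mod y B))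
  ... | Bézout.-+ x y 1+xA≡yB = 1ℤ - + (y ℕ.* B) , 1-yB≡0 , 1-yB≡1
    where
    open ≡-mod-Reasoning A
    1-yB≡0 : 1ℤ - + (y ℕ.* B) ≡ 0ℤ ⟨mod A ⟩
    1-yB≡0 = begin
      1ℤ - + (y ℕ.* B)        ≡⟨ cong (λ z → 1ℤ - + z) (sym 1+xA≡yB) ⟩
      1ℤ - (1ℤ + + (x ℕ.* A)) ≈⟨ +-cong-mod (≡-mod-refl 1ℤ) (neg-cong-mod
                                     (+-cong-mod (≡-mod-refl 1ℤ) (multiple≡0-mod x A))) ⟩
      0ℤ                      ∎
    1-yB≡1 : 1ℤ - + (y ℕ.* B) ≡ 1ℤ ⟨mod B ⟩
    1-yB≡1 = +-cong-mod (≡-mod-refl 1ℤ) (neg-cong-mod (multiple≡0-mod y B))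

  crt : ∀ {A B} → Coprime A B → .{{_ : ℕ.NonZero (A ℕ.* B)}} → ∀ (u v : ℤ) →
        Σ ℕ λ a → a < A ℕ.* B × + a ≡ u ⟨mod A ⟩ × + a ≡ v ⟨mod B ⟩
  crt {A} {B} coprime u v with separating-element coprime
  ... | e , e≡0 , e≡1 with reduce (u + (v - u) * e) (A ℕ.* B)
  ...   | a , a<AB , a≡ = a , a<AB , a≡u , a≡v
    where
    identity₀ : ∀ u w → u + w * 0ℤ ≡ u
    identity₀ = solve-∀
    identity₁ : ∀ u v → u + (v - u) * 1ℤ ≡ v
    identity₁ = solve-∀
    a≡u : + a ≡ u ⟨mod A ⟩
    a≡u = begin
      + a                   ≈⟨ ≡-mod-divisor (ℕD.m∣m*n B) a≡ ⟩
      u + (v - u) * e       ≈⟨ +-cong-mod (≡-mod-refl u) (*-cong-mod (≡-mod-refl (v - u)) e≡0) ⟩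
      u + (v - u) * 0ℤ      ≡⟨ identity₀ u (v - u) ⟩
      u                     ∎
      where open ≡-mod-Reasoning A
    a≡v : + a ≡ v ⟨mod B ⟩
    a≡v = begin
      + a                   ≈⟨ ≡-mod-divisor (ℕD.n∣m*n A) a≡ ⟩
      u + (v - u) * e       ≈⟨ +-cong-mod (≡-mod-refl u) (*-cong-mod (≡-mod-refl (v - u)) e≡1) ⟩
      u + (v - u) * 1ℤ      ≡⟨ identity₁ u v ⟩
      v                     ∎
      where open ≡-mod-Reasoning B

  ≡-mod? : ∀ n x y → Dec (x ≡ y ⟨mod n ⟩)
  ≡-mod? n x y = map′ (λ n∣ → mkCong (∣⇒∣ℤ n∣)) (λ x≡y → ∣ℤ⇒∣ (divides-difference x≡y))
                      (n ℕD.∣? ∣ x - y ∣)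

module PowersPrimesFermat where
  open import Data.Nat.Base as ℕ using (ℕ; zero; suc; _≤_; _<_; s≤s; z≤n; _!)
  import Data.Nat.Properties as ℕP
  open import Data.Nat.Divisibility as ℕD using (divides)
  open import Data.Nat.Primality using (Prime; euclidsLemma; prime⇒irreducible; prime⇒nonZero; ¬prime[0])
  open import Data.Nat.Primality.Factorisation using (factorise)
  open import Data.Nat.Coprimality using (Coprime)
  open import Data.Nat.ListAction using (product)
  open import Data.List.Base using ([]; _∷_)
  open import Data.List.Relation.Unary.All using (_∷_)
  open import Data.Nat.Combinatorics using (_C_; nCk≡n!/k![n-k]!; k![n∸k]!∣n!; nCn≡1)
  open import Data.Nat.DivMod using (m/n*n≡m)
  open import Data.Integer.Base using (+_; -_; _+_; _-_; _*_; _^_; 0ℤ; 1ℤ; -1ℤ; ∣_∣)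
  import Data.Integer.Properties as ℤP
  open import Data.Integer.Divisibility.Signed using () renaming (_∣_ to _∣ℤ_)
  open import Data.Integer.Tactic.RingSolver using (solve-∀)
  open import Data.Fin.Base using (Fin; toℕ; fromℕ; inject₁) renaming (zero to fzero; suc to fsuc)
  open import Data.Fin.Properties using (toℕ-fromℕ; toℕ-inject₁; toℕ<n)
  open import Data.Vec.Functional using (Vector)
  open import Algebra.Bundles using (CommutativeSemiring)
  import Algebra.Properties.CommutativeSemiring.Binomial as Binomial
  import Algebra.Properties.Monoid.Sum as MonoidSum
  import Algebra.Definitions.RawMonoid as RawMonoid
  open import Data.Sum using (_⊎_; inj₁; inj₂; [_,_]′)
  open import Data.Product using (Σ; _,_; _×_)
  open import Relation.Nullary using (¬_; contradiction)
  open import Relation.Binary.PropositionalEquality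
  open Congruences

  pos-^ : ∀ a k → + (a ℕ.^ k) ≡ (+ a) ^ k
  pos-^ a zero    = refl
  pos-^ a (suc k) = trans (ℤP.pos-* a (a ℕ.^ k)) (cong (+ a *_) (pos-^ a k))

  ^-* : ∀ x a b → x ^ (a ℕ.* b) ≡ (x ^ a) ^ b
  ^-* x a b = sym (ℤP.^-*-assoc x a b)

  square-of-power : ∀ x k → x ^ k * x ^ k ≡ x ^ (2 ℕ.* k)
  square-of-power x k = sym (trans (cong (x ^_) (cong (k ℕ.+_) (ℕP.+-identityʳ k))) (ℤP.^-distribˡ-+-* x k k))

  -1^odd : ∀ k → -1ℤ ^ suc (2 ℕ.* k) ≡ -1ℤ
  -1^odd k = cong (-1ℤ *_) (trans (^-* -1ℤ 2 k) (ℤP.^-zeroˡ k))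

  neg-^-odd : ∀ x k → (- x) ^ suc (2 ℕ.* k) ≡ - (x ^ suc (2 ℕ.* k))
  neg-^-odd x k = begin
    (- x) * (- x) ^ (2 ℕ.* k) ≡⟨ cong ((- x) *_) (^-* (- x) 2 k) ⟩
    (- x) * ((- x) ^ 2) ^ k   ≡⟨ cong (λ y → (- x) * y ^ k) (square-neg x) ⟩
    (- x) * (x ^ 2) ^ k       ≡⟨ cong (λ y → (- x) * y) (sym (^-* x 2 k)) ⟩
    (- x) * x ^ (2 ℕ.* k)     ≡⟨ ℤP.neg-distribˡ-* x (x ^ (2 ℕ.* k)) ⟨
    - (x ^ suc (2 ℕ.* k))     ∎
    where
    open ≡-Reasoning
    square-neg : ∀ x → (- x) * ((- x) * 1ℤ) ≡ x * (x * 1ℤ)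
    square-neg = solve-∀

  prime≥2 : ∀ {p} → Prime p → 2 ≤ p
  prime≥2 {p} record{} = ℕ.nonTrivial⇒n>1 p

  prime∤1 : ∀ {p} → Prime p → ¬ p ℕD.∣ 1
  prime∤1 pp p∣1 with ℕD.∣1⇒≡1 p∣1 | prime≥2 pp
  ... | refl | s≤s ()

  euclidℤ : ∀ {p} x y → Prime p → + p ∣ℤ (x * y) → + p ∣ℤ x ⊎ + p ∣ℤ y
  euclidℤ {p} x y pp p∣xy
    with euclidsLemma ∣ x ∣ ∣ y ∣ pp (subst (p ℕD.∣_) (ℤP.abs-* x y) (∣ℤ⇒∣ p∣xy))
  ... | inj₁ p∣x = inj₁ (∣⇒∣ℤ p∣x)
  ... | inj₂ p∣y = inj₂ (∣⇒∣ℤ p∣y)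

  prime-divisor : ∀ n → 1 < n → Σ ℕ λ p → Prime p × p ℕD.∣ n
  prime-divisor n@(suc _) 1<n with factorise n
  ... | record { factors = [] ; isFactorisation = n≡1 } = contradiction (sym n≡1) (ℕP.<⇒≢ 1<n)
  ... | record { factors = p ∷ ps ; isFactorisation = n≡p*ps ; factorsPrime = pp ∷ _ } =
    p , pp , divides (product ps) (trans n≡p*ps (ℕP.*-comm p (product ps)))

  prime∣prime-power : ∀ {p q} e → Prime p → Prime q → q ℕD.∣ p ℕ.^ e → q ≡ p
  prime∣prime-power zero    _  qq q∣1 = contradiction q∣1 (prime∤1 qq)
  prime∣prime-power {p} (suc e) pp qq q∣pᵉ⁺¹ with euclidsLemma p (p ℕ.^ e) qq q∣pᵉ⁺¹
  ... | inj₂ q∣pᵉ = prime∣prime-power e pp qq q∣pᵉ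
  ... | inj₁ q∣p with prime⇒irreducible pp q∣p
  ...   | inj₁ refl = contradiction ℕD.∣-refl (prime∤1 qq)
  ...   | inj₂ q≡p  = q≡p

  coprime-prime-power : ∀ {p M} e → Prime p → ¬ p ℕD.∣ M → Coprime (p ℕ.^ e) M
  coprime-prime-power {p} e pp p∤M {zero} (_ , 0∣M) =
    contradiction (subst (p ℕD.∣_) (sym (ℕD.0∣⇒≡0 0∣M)) (ℕD._∣0 p)) p∤M
  coprime-prime-power e pp p∤M {1} _ = refl
  coprime-prime-power e pp p∤M {d@(suc (suc _))} (d∣pᵉ , d∣M)
    with prime-divisor d (s≤s (s≤s z≤n))
  ... | q , qq , q∣d with prime∣prime-power e pp qq (ℕD.∣-trans q∣d d∣pᵉ)
  ...   | refl = contradiction (ℕD.∣-trans q∣d d∣M) p∤M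

  prime∤factorial : ∀ {p} m → Prime p → m < p → ¬ p ℕD.∣ m !
  prime∤factorial zero    pp _   = prime∤1 pp
  prime∤factorial (suc m) pp m<p p∣m! with euclidsLemma (suc m) (m !) pp p∣m!
  ... | inj₁ p∣1+m = ℕD.>⇒∤ m<p p∣1+m
  ... | inj₂ p∣m!  = prime∤factorial m pp (ℕP.<-trans (ℕP.n<1+n m) m<p) p∣m!

  -- p divides (p C k) for 0 < k < p: p divides p! = (p C k) * k! * (p - k)!
  -- but neither factorial.
  prime∣binomial : ∀ {p k} → Prime p → 0 < k → k < p → p ℕD.∣ (p C k)
  prime∣binomial {p@(suc p-1)} {k} pp 0<k k<p with euclidsLemma (p C k) _ pp p∣product
    where
    instance
      _ : ℕ.NonZero (k ! ℕ.* (p ℕ.∸ k) !)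
      _ = ℕP.m*n≢0 (k !) ((p ℕ.∸ k) !) {{k ℕP.!≢0}} {{(p ℕ.∸ k) ℕP.!≢0}}
    factorial-identity : (p C k) ℕ.* (k ! ℕ.* (p ℕ.∸ k) !) ≡ p !
    factorial-identity = trans (cong (ℕ._* (k ! ℕ.* (p ℕ.∸ k) !)) (nCk≡n!/k![n-k]! (ℕP.<⇒≤ k<p)))
                               (m/n*n≡m (k![n∸k]!∣n! (ℕP.<⇒≤ k<p)))
    p∣product : p ℕD.∣ (p C k) ℕ.* (k ! ℕ.* (p ℕ.∸ k) !)
    p∣product = subst (p ℕD.∣_) (sym factorial-identity) (ℕD.m∣m*n (p-1 !))
  ... | inj₁ p∣pCk = p∣pCk
  ... | inj₂ p∣k![p-k]! with euclidsLemma (k !) ((p ℕ.∸ k) !) pp p∣k![p-k]!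
  ...   | inj₁ p∣k!     = contradiction p∣k! (prime∤factorial k pp k<p)
  ...   | inj₂ p∣[p-k]! = contradiction p∣[p-k]!
                            (prime∤factorial (p ℕ.∸ k) pp (ℕP.∸-monoʳ-< 0<k (ℕP.<⇒≤ k<p)))

  module _ where
    open CommutativeSemiring ℕP.+-*-commutativeSemiring using (semiring; +-rawMonoid; +-monoid)
    open Binomial ℕP.+-*-commutativeSemiring using (theorem)
    open import Algebra.Properties.Semiring.Exp semiring using () renaming (_^_ to _^ₛ_)
    open RawMonoid +-rawMonoid using (sum) renaming (_×_ to _×ₛ_)
    open MonoidSum +-monoid using (sum-init-last)

    private
      ^ₛ≡^ : ∀ x n → x ^ₛ n ≡ x ℕ.^ n
      ^ₛ≡^ x zero    = refl
      ^ₛ≡^ x (suc n) = cong (x ℕ.*_) (^ₛ≡^ x n)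

      ×ₛ≡* : ∀ n x → n ×ₛ x ≡ n ℕ.* x
      ×ₛ≡* zero    x = refl
      ×ₛ≡* (suc n) x = cong (x ℕ.+_) (×ₛ≡* n x)

      1^ₛ : ∀ n → 1 ^ₛ n ≡ 1
      1^ₛ n = trans (^ₛ≡^ 1 n) (ℕP.^-zeroˡ n)

      sum-divisible : ∀ {d} n (f : Vector ℕ n) → (∀ i → d ℕD.∣ f i) → d ℕD.∣ sum f
      sum-divisible zero    f d∣f = ℕD._∣0 _
      sum-divisible (suc n) f d∣f =
        ℕD.∣m∣n⇒∣m+n (d∣f fzero) (sum-divisible n (λ i → f (fsuc i)) (λ i → d∣f (fsuc i)))

      term : ∀ n a → Fin (suc n) → ℕ
      term n a k = (n C toℕ k) ×ₛ (a ^ₛ toℕ k ℕ.* 1 ^ₛ (n ℕ.∸ toℕ k))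

      first-term : ∀ n a → term n a fzero ≡ 1
      first-term n a = begin
        (n C 0) ×ₛ (1 ℕ.* 1 ^ₛ n)   ≡⟨ ×ₛ≡* (n C 0) _ ⟩
        1 ℕ.* (1 ℕ.* 1 ^ₛ n)        ≡⟨ cong (λ z → 1 ℕ.* (1 ℕ.* z)) (1^ₛ n) ⟩
        1                           ∎
        where open ≡-Reasoning

      last-term : ∀ n a → term n a (fromℕ n) ≡ a ℕ.^ n
      last-term n a = begin
        term n a (fromℕ n)                      ≡⟨ cong (λ j → (n C j) ×ₛ (a ^ₛ j ℕ.* 1 ^ₛ (n ℕ.∸ j))) (toℕ-fromℕ n) ⟩
        (n C n) ×ₛ (a ^ₛ n ℕ.* 1 ^ₛ (n ℕ.∸ n))  ≡⟨ ×ₛ≡* (n C n) _ ⟩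
        (n C n) ℕ.* (a ^ₛ n ℕ.* 1 ^ₛ (n ℕ.∸ n)) ≡⟨ cong₂ (λ c z → c ℕ.* (z ℕ.* 1 ^ₛ (n ℕ.∸ n))) (nCn≡1 n) (^ₛ≡^ a n) ⟩
        1 ℕ.* (a ℕ.^ n ℕ.* 1 ^ₛ (n ℕ.∸ n))      ≡⟨ cong (λ z → 1 ℕ.* (a ℕ.^ n ℕ.* z)) (1^ₛ (n ℕ.∸ n)) ⟩
        1 ℕ.* (a ℕ.^ n ℕ.* 1)                   ≡⟨ trans (ℕP.*-identityˡ _) (ℕP.*-identityʳ _) ⟩
        a ℕ.^ n                                 ∎
        where open ≡-Reasoning

      middle : ∀ n a → ℕ
      middle n a = sum (λ i → term (suc n) a (fsuc (inject₁ i)))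

      expansion : ∀ n a → (a ℕ.+ 1) ℕ.^ suc n ≡ 1 ℕ.+ (middle n a ℕ.+ a ℕ.^ suc n)
      expansion n a = begin
        (a ℕ.+ 1) ℕ.^ suc n                                     ≡⟨ ^ₛ≡^ (a ℕ.+ 1) (suc n) ⟨
        (a ℕ.+ 1) ^ₛ suc n                                      ≡⟨ theorem (suc n) a 1 ⟩
        term (suc n) a fzero ℕ.+ sum (λ i → term (suc n) a (fsuc i))
          ≡⟨ cong₂ ℕ._+_ (first-term (suc n) a) (sum-init-last (λ i → term (suc n) a (fsuc i))) ⟩
        1 ℕ.+ (middle n a ℕ.+ term (suc n) a (fromℕ (suc n)))   ≡⟨ cong (λ z → 1 ℕ.+ (middle n a ℕ.+ z)) (last-term (suc n) a) ⟩
        1 ℕ.+ (middle n a ℕ.+ a ℕ.^ suc n)                      ∎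
        where open ≡-Reasoning

    -- Freshman's dream: (a + 1) ^ p = 1 + S + a ^ p with p ∣ S, since the
    -- intermediate binomial coefficients are multiples of p.
    freshman : ∀ {p} → Prime p → ∀ a →
               Σ ℕ λ S → p ℕD.∣ S × (a ℕ.+ 1) ℕ.^ p ≡ 1 ℕ.+ (S ℕ.+ a ℕ.^ p)
    freshman {zero}    pp = contradiction pp ¬prime[0]
    freshman {suc p-1} pp a = middle p-1 a , sum-divisible p-1 _ p∣middle , expansion p-1 a
      where
      p∣middle : ∀ i → suc p-1 ℕD.∣ term (suc p-1) a (fsuc (inject₁ i))
      p∣middle i = subst (suc p-1 ℕD.∣_) (sym (×ₛ≡* (suc p-1 C k) _))
                     (ℕD.∣m⇒∣m*n _ (prime∣binomial pp (s≤s z≤n) k<p))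
        where
        k = suc (toℕ (inject₁ i))
        k<p : k < suc p-1
        k<p = subst (λ j → suc j < suc p-1) (sym (toℕ-inject₁ i)) (s≤s (toℕ<n i))

  -- Fermat's little theorem x ^ p ≡ x (mod p): first for naturals by induction
  -- using the freshman's dream, then for integers by reduction to a residue.
  fermatℕ : ∀ {p} → Prime p → ∀ a → (+ a) ^ p ≡ + a ⟨mod p ⟩
  fermatℕ {p} pp zero with prime≥2 pp
  fermatℕ {suc (suc _)} pp zero | s≤s (s≤s z≤n) = ≡-mod-refl 0ℤ
  fermatℕ {p} pp (suc a) with freshman pp a
  ... | S , divides k S≡kp , expansion = begin
    (+ suc a) ^ p                  ≡⟨ pos-^ (suc a) p ⟨
    + (suc a ℕ.^ p)                ≡⟨ cong +_ (trans (cong (ℕ._^ p) (ℕP.+-comm 1 a)) expansion) ⟩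
    1ℤ + (+ S + + (a ℕ.^ p))       ≈⟨ +-cong-mod (≡-mod-refl 1ℤ) (+-cong-mod S≡0 (≡-mod-reflexive (pos-^ a p))) ⟩
    1ℤ + (0ℤ + (+ a) ^ p)          ≈⟨ +-cong-mod (≡-mod-refl 1ℤ) (+-cong-mod (≡-mod-refl 0ℤ) (fermatℕ pp a)) ⟩
    1ℤ + (0ℤ + + a)                ≡⟨ cong (λ z → 1ℤ + z) (ℤP.+-identityˡ (+ a)) ⟩
    + suc a                        ∎
    where
    open ≡-mod-Reasoning p
    S≡0 : + S ≡ 0ℤ ⟨mod p ⟩
    S≡0 = subst (λ z → + z ≡ 0ℤ ⟨mod p ⟩) (sym S≡kp) (multiple≡0-mod k p)

  fermat : ∀ {p} → Prime p → ∀ x → x ^ p ≡ x ⟨mod p ⟩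
  fermat {p} pp x with reduce x p {{prime⇒nonZero pp}}
  ... | r , _ , r≡x = ≡-mod-trans (^-cong-mod p (≡-mod-sym r≡x)) (≡-mod-trans (fermatℕ pp r) r≡x)

  fermat-unit : ∀ {p} → Prime p → ∀ x → ¬ + p ∣ℤ x → x ^ (p ℕ.∸ 1) ≡ 1ℤ ⟨mod p ⟩
  fermat-unit {zero}    pp = contradiction pp ¬prime[0]
  fermat-unit {suc p-1} pp x p∤x =
    [ (λ p∣x → contradiction p∣x p∤x) , mkCong ]′ (euclidℤ x (x ^ p-1 - 1ℤ) pp p∣x[xᵖ⁻¹-1])
    where
    identity : ∀ x y → x * y - x ≡ x * (y - 1ℤ)
    identity = solve-∀
    p∣x[xᵖ⁻¹-1] : + suc p-1 ∣ℤ (x * (x ^ p-1 - 1ℤ))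
    p∣x[xᵖ⁻¹-1] = subst (+ suc p-1 ∣ℤ_) (identity x (x ^ p-1)) (divides-difference (fermat pp x))

  fermat-iterated : ∀ {p} → Prime p → ∀ x j → x ^ (p ℕ.^ j) ≡ x ⟨mod p ⟩
  fermat-iterated pp x zero    = ≡-mod-reflexive (ℤP.*-identityʳ x)
  fermat-iterated {p} pp x (suc j) = begin
    x ^ (p ℕ.* p ℕ.^ j)   ≡⟨ trans (cong (x ^_) (ℕP.*-comm p (p ℕ.^ j))) (^-* x (p ℕ.^ j) p) ⟩
    (x ^ (p ℕ.^ j)) ^ p   ≈⟨ fermat pp (x ^ (p ℕ.^ j)) ⟩
    x ^ (p ℕ.^ j)         ≈⟨ fermat-iterated pp x j ⟩
    x                     ∎
    where open ≡-mod-Reasoning p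

module RootsOfUnity where
  open import Data.Nat.Base as ℕ using (ℕ; zero; suc; _<_)
  import Data.Nat.Properties as ℕP
  open import Data.Nat.Divisibility as ℕD using (divides)
  open import Data.Nat.Primality using (Prime)
  open import Data.Nat.Coprimality using (Coprime; coprime-Bézout)
  open import Data.Nat.GCD using (module Bézout)
  open import Data.Integer.Base using (ℤ; +_; -_; _+_; _-_; _*_; _^_; 0ℤ; 1ℤ)
  import Data.Integer.Properties as ℤP
  open import Data.Integer.Divisibility.Signed using (divides) renaming (_∣_ to _∣ℤ_)
  open import Data.Integer.Tactic.RingSolver using (solve-∀)
  open import Data.Sum using (inj₁; inj₂)
  open import Data.Product using (_,_; _×_)
  open import Relation.Nullary using (¬_; contradiction)
  open import Relation.Binary.PropositionalEquality
  open Congruences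
  open PowersPrimesFermat

  geometric : ℤ → ℕ → ℤ
  geometric x zero    = 0ℤ
  geometric x (suc m) = 1ℤ + x * geometric x m

  geometric-identity : ∀ x m → x ^ m - 1ℤ ≡ (x - 1ℤ) * geometric x m
  geometric-identity x zero    = sym (ℤP.*-zeroʳ (x - 1ℤ))
  geometric-identity x (suc m) = begin
    x * x ^ m - 1ℤ                           ≡⟨ split x (x ^ m) ⟩
    x * (x ^ m - 1ℤ) + (x - 1ℤ)              ≡⟨ cong (λ z → x * z + (x - 1ℤ)) (geometric-identity x m) ⟩
    x * ((x - 1ℤ) * geometric x m) + (x - 1ℤ) ≡⟨ collect x (geometric x m) ⟩
    (x - 1ℤ) * (1ℤ + x * geometric x m)      ∎
    where
    open ≡-Reasoning
    split : ∀ x y → x * y - 1ℤ ≡ x * (y - 1ℤ) + (x - 1ℤ)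
    split = solve-∀
    collect : ∀ x g → x * ((x - 1ℤ) * g) + (x - 1ℤ) ≡ (x - 1ℤ) * (1ℤ + x * g)
    collect = solve-∀

  geometric≡length : ∀ {d} x m → x ≡ 1ℤ ⟨mod d ⟩ → geometric x m ≡ + m ⟨mod d ⟩
  geometric≡length x zero    _   = ≡-mod-refl 0ℤ
  geometric≡length x (suc m) x≡1 =
    ≡-mod-trans (+-cong-mod (≡-mod-refl 1ℤ) (*-cong-mod x≡1 (geometric≡length x m x≡1)))
                (≡-mod-reflexive (cong (λ z → 1ℤ + z) (ℤP.*-identityˡ (+ m))))

  -- Lifting a root of unity: if x ≡ 1 modulo p and modulo D, and x ^ m ≡ 1
  -- modulo p D for some m prime to p, then already x ≡ 1 (mod p D).
  -- (Write x - 1 = t D; then t G(x,m) = u p and G(x,m) ≡ m ≢ 0 (mod p).)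
  lift-root-of-unity : ∀ {p D} x m → Prime p → ¬ p ℕD.∣ m →
                       x ≡ 1ℤ ⟨mod p ⟩ → x ≡ 1ℤ ⟨mod D ⟩ → x ^ m ≡ 1ℤ ⟨mod p ℕ.* D ⟩ →
                       x ≡ 1ℤ ⟨mod p ℕ.* D ⟩
  lift-root-of-unity {p} {zero} x m pp p∤m _ x≡1 _ = subst (λ z → x ≡ 1ℤ ⟨mod z ⟩) (sym (ℕP.*-zeroʳ p)) x≡1
  lift-root-of-unity {p} {D@(suc _)} x m pp p∤m x≡1[p] (mkCong (divides t x-1≡tD)) (mkCong (divides u xᵐ-1≡upD))
    with euclidℤ t G pp (divides u tG≡up)
    where
    G = geometric x m
    identity₁ : ∀ t g d → (t * g) * d ≡ (t * d) * g
    identity₁ = solve-∀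
    identity₂ : ∀ u p d → u * (p * d) ≡ (u * p) * d
    identity₂ = solve-∀
    tG≡up : t * G ≡ u * + p
    tG≡up = ℤP.*-cancelʳ-≡ (t * G) (u * + p) (+ D) (begin
      (t * G) * + D         ≡⟨ identity₁ t G (+ D) ⟩
      (t * + D) * G         ≡⟨ cong (_* G) x-1≡tD ⟨
      (x - 1ℤ) * G          ≡⟨ geometric-identity x m ⟨
      x ^ m - 1ℤ            ≡⟨ xᵐ-1≡upD ⟩
      u * + (p ℕ.* D)       ≡⟨ cong (u *_) (ℤP.pos-* p D) ⟩
      u * (+ p * + D)       ≡⟨ identity₂ u (+ p) (+ D) ⟩
      (u * + p) * + D       ∎)
      where open ≡-Reasoning
  ... | inj₁ (divides s t≡sp) = mkCong (divides s (begin
    x - 1ℤ                ≡⟨ x-1≡tD ⟩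
    t * + D               ≡⟨ cong (_* + D) t≡sp ⟩
    s * + p * + D         ≡⟨ ℤP.*-assoc s (+ p) (+ D) ⟩
    s * (+ p * + D)       ≡⟨ cong (s *_) (ℤP.pos-* p D) ⟨
    s * + (p ℕ.* D)       ∎))
    where open ≡-Reasoning
  ... | inj₂ p∣G = contradiction p∣m p∤m
    where
    p∣m : p ℕD.∣ m
    p∣m = ∣ℤ⇒∣ (≡0-mod⇒∣ (≡-mod-trans (≡-mod-sym (geometric≡length x m x≡1[p])) (∣⇒≡0-mod p∣G)))

  root-of-unity-mod-prime-power : ∀ {p} x m j → Prime p → ¬ p ℕD.∣ m → x ≡ 1ℤ ⟨mod p ⟩ →
                                  x ^ m ≡ 1ℤ ⟨mod p ℕ.^ j ⟩ → x ≡ 1ℤ ⟨mod p ℕ.^ j ⟩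
  root-of-unity-mod-prime-power x m zero    pp p∤m x≡1 _  = ≡-mod-1 x 1ℤ
  root-of-unity-mod-prime-power {p} x m (suc j) pp p∤m x≡1 xᵐ≡1 =
    lift-root-of-unity x m pp p∤m x≡1
      (root-of-unity-mod-prime-power x m j pp p∤m x≡1 (≡-mod-divisor (ℕD.n∣m*n p) xᵐ≡1)) xᵐ≡1

  -- With x - 1 = t d, d = w p and
  -- G(x,p) = p + v d, we get x ^ p - 1 = t (1 + v w) p d.
  power-gains-modulus : ∀ {p d} x → p ℕD.∣ d → x ≡ 1ℤ ⟨mod d ⟩ → x ^ p ≡ 1ℤ ⟨mod p ℕ.* d ⟩
  power-gains-modulus {p} {d} x (divides w d≡wp) x≡1@(mkCong (divides t x-1≡td))
    with divides-difference (geometric≡length {d} x p x≡1)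
  ... | divides v G-p≡vd = mkCong (divides (t * (1ℤ + v * + w)) (begin
    x ^ p - 1ℤ                             ≡⟨ geometric-identity x p ⟩
    (x - 1ℤ) * geometric x p               ≡⟨ cong₂ _*_ x-1≡td G≡p+vd ⟩
    (t * + d) * (+ p + v * + d)            ≡⟨ cong (λ z → (t * z) * (+ p + v * z)) d≡wp′ ⟩
    (t * (+ w * + p)) * (+ p + v * (+ w * + p)) ≡⟨ regroup t v (+ w) (+ p) ⟩
    t * (1ℤ + v * + w) * (+ p * (+ w * + p)) ≡⟨ cong (λ z → t * (1ℤ + v * + w) * (+ p * z)) d≡wp′ ⟨
    t * (1ℤ + v * + w) * (+ p * + d)       ≡⟨ cong (t * (1ℤ + v * + w) *_) (ℤP.pos-* p d) ⟨
    t * (1ℤ + v * + w) * + (p ℕ.* d)       ∎))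
    where
    open ≡-Reasoning
    d≡wp′ : + d ≡ + w * + p
    d≡wp′ = trans (cong +_ d≡wp) (ℤP.pos-* w p)
    add-back : ∀ g p → p + (g - p) ≡ g
    add-back = solve-∀
    G≡p+vd : geometric x p ≡ + p + v * + d
    G≡p+vd = trans (sym (add-back (geometric x p) (+ p))) (cong (λ z → + p + z) G-p≡vd)
    regroup : ∀ t v w p → (t * (w * p)) * (p + v * (w * p)) ≡ t * (1ℤ + v * w) * (p * (w * p))
    regroup = solve-∀

  prime-power-root-of-unity : ∀ {p} x j → x ≡ 1ℤ ⟨mod p ⟩ → x ^ (p ℕ.^ j) ≡ 1ℤ ⟨mod p ℕ.^ suc j ⟩
  prime-power-root-of-unity {p} x zero x≡1 =
    subst₂ (λ a b → a ≡ 1ℤ ⟨mod b ⟩) (sym (ℤP.*-identityʳ x)) (sym (ℕP.*-identityʳ p)) x≡1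
  prime-power-root-of-unity {p} x (suc j) x≡1 =
    subst (λ z → z ≡ 1ℤ ⟨mod p ℕ.^ suc (suc j) ⟩)
      (trans (sym (^-* x (p ℕ.^ j) p)) (cong (x ^_) (ℕP.*-comm (p ℕ.^ j) p)))
      (power-gains-modulus {p} (x ^ (p ℕ.^ j)) (ℕD.m∣m*n (p ℕ.^ j)) (prime-power-root-of-unity x j x≡1))

  teichmüller : ∀ {p} e → Prime p → ∀ x → ¬ + p ∣ℤ x →
                (x ^ (p ℕ.^ e)) ^ (p ℕ.∸ 1) ≡ 1ℤ ⟨mod p ℕ.^ suc e ⟩ × x ^ (p ℕ.^ e) ≡ x ⟨mod p ⟩
  teichmüller {p} e pp x p∤x = root-of-unity , fermat-iterated pp x e
    where
    commute : (x ^ (p ℕ.^ e)) ^ (p ℕ.∸ 1) ≡ (x ^ (p ℕ.∸ 1)) ^ (p ℕ.^ e)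
    commute = trans (sym (^-* x (p ℕ.^ e) (p ℕ.∸ 1)))
                    (trans (cong (x ^_) (ℕP.*-comm (p ℕ.^ e) (p ℕ.∸ 1))) (^-* x (p ℕ.∸ 1) (p ℕ.^ e)))
    root-of-unity : (x ^ (p ℕ.^ e)) ^ (p ℕ.∸ 1) ≡ 1ℤ ⟨mod p ℕ.^ suc e ⟩
    root-of-unity = subst (λ z → z ≡ 1ℤ ⟨mod p ℕ.^ suc e ⟩) (sym commute)
                      (prime-power-root-of-unity (x ^ (p ℕ.∸ 1)) e (fermat-unit pp x p∤x))

  root-of-unity-power : ∀ {n x} a c → x ^ a ≡ 1ℤ ⟨mod n ⟩ → x ^ (c ℕ.* a) ≡ 1ℤ ⟨mod n ⟩
  root-of-unity-power {n} {x} a c xᵃ≡1 = begin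
    x ^ (c ℕ.* a)  ≡⟨ trans (cong (x ^_) (ℕP.*-comm c a)) (^-* x a c) ⟩
    (x ^ a) ^ c    ≈⟨ ^-cong-mod c xᵃ≡1 ⟩
    1ℤ ^ c         ≡⟨ ℤP.^-zeroˡ c ⟩
    1ℤ             ∎
    where open ≡-mod-Reasoning n

  private
    root-of-unity-cancel : ∀ {n x} b v k → x ^ b ≡ 1ℤ ⟨mod n ⟩ → 1 ℕ.+ v ℕ.* b ≡ k →
                           x ^ k ≡ 1ℤ ⟨mod n ⟩ → x ≡ 1ℤ ⟨mod n ⟩
    root-of-unity-cancel {n} {x} b v k xᵇ≡1 1+vb≡k xᵏ≡1 = begin
      x                     ≡⟨ ℤP.*-identityʳ x ⟨
      x * 1ℤ                ≈⟨ *-cong-mod (≡-mod-refl x) (root-of-unity-power b v xᵇ≡1) ⟨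
      x ^ (1 ℕ.+ v ℕ.* b)   ≡⟨ cong (x ^_) 1+vb≡k ⟩
      x ^ k                 ≈⟨ xᵏ≡1 ⟩
      1ℤ                    ∎
      where open ≡-mod-Reasoning n

  root-of-unity-coprime : ∀ {n x} a b → Coprime a b →
                          x ^ a ≡ 1ℤ ⟨mod n ⟩ → x ^ b ≡ 1ℤ ⟨mod n ⟩ → x ≡ 1ℤ ⟨mod n ⟩
  root-of-unity-coprime a b coprime xᵃ≡1 xᵇ≡1 with coprime-Bézout coprime
  ... | Bézout.+- u v 1+vb≡ua = root-of-unity-cancel b v (u ℕ.* a) xᵇ≡1 1+vb≡ua (root-of-unity-power a u xᵃ≡1)
  ... | Bézout.-+ u v 1+ua≡vb = root-of-unity-cancel a u (v ℕ.* b) xᵃ≡1 1+ua≡vb (root-of-unity-power b v xᵇ≡1)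

  root-of-unity-unit : ∀ {p x m} → Prime p → 0 < m → x ^ m ≡ 1ℤ ⟨mod p ⟩ → ¬ + p ∣ℤ x
  root-of-unity-unit {p} {x} {suc m} pp _ xᵐ⁺¹≡1 p∣x = prime∤1 pp (∣ℤ⇒∣ (≡0-mod⇒∣ (begin
    1ℤ              ≈⟨ xᵐ⁺¹≡1 ⟨
    x * x ^ m       ≈⟨ *-cong-mod (∣⇒≡0-mod p∣x) (≡-mod-refl (x ^ m)) ⟩
    0ℤ * x ^ m      ≡⟨ ℤP.*-zeroˡ (x ^ m) ⟩
    0ℤ              ∎)))
    where open ≡-mod-Reasoning p

module Lagrange where
  open import Data.Nat.Base as ℕ using (ℕ; zero; suc; _≤_; _<_; s≤s; z≤n)
  import Data.Nat.Properties as ℕP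
  import Data.Nat.Divisibility as ℕD
  open import Data.Nat.Primality using (Prime)
  open import Data.Integer.Base using (ℤ; +_; -_; _+_; _-_; _*_; _^_; 0ℤ; 1ℤ; -1ℤ)
  import Data.Integer.Properties as ℤP
  open import Data.Integer.Divisibility.Signed using () renaming (_∣_ to _∣ℤ_)
  open import Data.Integer.Tactic.RingSolver using (solve-∀)
  open import Data.List.Base using (List; []; _∷_; length; replicate)
  open import Data.List.Properties using (length-replicate)
  open import Data.List.Relation.Unary.All using (All; []; _∷_)
  open import Data.List.Relation.Unary.AllPairs using (AllPairs; []; _∷_)
  open import Data.Sum using (_⊎_; inj₁; inj₂)
  open import Data.Product using (Σ; _,_; _×_)
  open import Relation.Nullary using (¬_; yes; no; contradiction)
  open import Relation.Binary.PropositionalEquality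
  open Congruences
  open PowersPrimesFermat

  -- Monic polynomials over ℤ, given by the list of their lower coefficients
  -- (constant term first); the leading coefficient 1 is implicit, so the
  -- degree is the length of the list.
  evalMonic : List ℤ → ℤ → ℤ
  evalMonic []       x = 1ℤ
  evalMonic (c ∷ cs) x = c + x * evalMonic cs x

  -- Synthetic division of a monic polynomial of positive degree by x - r.
  deflate : ℤ → List ℤ → List ℤ
  deflate r []           = []
  deflate r (c ∷ [])     = []
  deflate r (c ∷ d ∷ ds) = evalMonic (d ∷ ds) r ∷ deflate r (d ∷ ds)

  deflate-length : ∀ r c cs → length (deflate r (c ∷ cs)) ≡ length cs
  deflate-length r c []       = refl
  deflate-length r c (d ∷ ds) = cong suc (deflate-length r d ds)

  factor-theorem : ∀ r c cs x →
                   evalMonic (c ∷ cs) x - evalMonic (c ∷ cs) r ≡ (x - r) * evalMonic (deflate r (c ∷ cs)) x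
  factor-theorem r c []       x = identity c x r
    where
    identity : ∀ c x r → c + x * 1ℤ - (c + r * 1ℤ) ≡ (x - r) * 1ℤ
    identity = solve-∀
  factor-theorem r c (d ∷ ds) x = begin
    c + x * A - (c + r * B)           ≡⟨ split c x r A B ⟩
    x * (A - B) + (x - r) * B         ≡⟨ cong (λ z → x * z + (x - r) * B) (factor-theorem r d ds x) ⟩
    x * ((x - r) * Q) + (x - r) * B   ≡⟨ collect x r B Q ⟩
    (x - r) * (B + x * Q)             ∎
    where
    open ≡-Reasoning
    A = evalMonic (d ∷ ds) x
    B = evalMonic (d ∷ ds) r
    Q = evalMonic (deflate r (d ∷ ds)) x
    split : ∀ c x r A B → c + x * A - (c + r * B) ≡ x * (A - B) + (x - r) * B
    split = solve-∀
    collect : ∀ x r B Q → x * ((x - r) * Q) + (x - r) * B ≡ (x - r) * (B + x * Q)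
    collect = solve-∀

  module _ {p : ℕ} (pp : Prime p) where

    Incongruent : ℤ → ℤ → Set
    Incongruent a b = ¬ (a ≡ b ⟨mod p ⟩)

    IsRoot : List ℤ → ℤ → Set
    IsRoot cs r = evalMonic cs r ≡ 0ℤ ⟨mod p ⟩

    deflate-roots : ∀ r c cs {rs} → All (Incongruent r) rs → IsRoot (c ∷ cs) r →
                    All (IsRoot (c ∷ cs)) rs → All (IsRoot (deflate r (c ∷ cs))) rs
    deflate-roots r c cs []             _      []           = []
    deflate-roots r c cs (r≢r' ∷ r≢rs) f[r]≡0 (f[r']≡0 ∷ f[rs]≡0) =
      root-of-quotient ∷ deflate-roots r c cs r≢rs f[r]≡0 f[rs]≡0
      where
      r' = _
      p∣product : + p ∣ℤ ((r' - r) * evalMonic (deflate r (c ∷ cs)) r')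
      p∣product = subst (+ p ∣ℤ_) (factor-theorem r c cs r')
                    (≡0-mod⇒∣ (≡-mod-trans (+-cong-mod f[r']≡0 (neg-cong-mod f[r]≡0)) (≡-mod-refl 0ℤ)))
      root-of-quotient : IsRoot (deflate r (c ∷ cs)) r'
      root-of-quotient with euclidℤ (r' - r) _ pp p∣product
      ... | inj₁ p∣r'-r = contradiction (≡-mod-sym (mkCong p∣r'-r)) r≢r'
      ... | inj₂ p∣q    = ∣⇒≡0-mod p∣q

    lagrange : ∀ cs rs → length cs < length rs → AllPairs Incongruent rs → ¬ All (IsRoot cs) rs
    lagrange []       (r ∷ rs) _          _               (1≡0 ∷ _) =
      prime∤1 pp (∣ℤ⇒∣ (≡0-mod⇒∣ 1≡0))
    lagrange (c ∷ cs) (r ∷ rs) (s≤s deg<) (r≢rs ∷ distinct) (f[r]≡0 ∷ f[rs]≡0) =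
      lagrange (deflate r (c ∷ cs)) rs (subst (_< length rs) (sym (deflate-length r c cs)) deg<)
               distinct (deflate-roots r c cs r≢rs f[r]≡0 f[rs]≡0)

    unity-polynomial : ℕ → List ℤ
    unity-polynomial m = -1ℤ ∷ replicate m 0ℤ

    unity-polynomial-length : ∀ m → length (unity-polynomial m) ≡ suc m
    unity-polynomial-length m = cong suc (length-replicate m)

    eval-unity-polynomial : ∀ m x → evalMonic (unity-polynomial m) x ≡ x ^ suc m - 1ℤ
    eval-unity-polynomial m x = trans (cong (λ z → -1ℤ + x * z) (eval-powers m)) (ℤP.+-comm -1ℤ (x ^ suc m))
      where
      eval-powers : ∀ k → evalMonic (replicate k 0ℤ) x ≡ x ^ k
      eval-powers zero    = refl
      eval-powers (suc k) = trans (ℤP.+-identityˡ _) (cong (x *_) (eval-powers k))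

    residues : ℕ → List ℤ
    residues zero    = []
    residues (suc k) = + suc k ∷ residues k

    residues-length : ∀ k → length (residues k) ≡ k
    residues-length zero    = refl
    residues-length (suc k) = cong suc (residues-length k)

    residues-below : ∀ k a → k < a → a < p → All (Incongruent (+ a)) (residues k)
    residues-below zero    a _   _   = []
    residues-below (suc k) a k<a a<p =
      (λ a≡k → ℕP.<⇒≢ k<a (sym (residue-unique a<p (ℕP.<-trans k<a a<p) a≡k)))
      ∷ residues-below k a (ℕP.<-trans (ℕP.n<1+n k) k<a) a<p

    residues-distinct : ∀ k → k < p → AllPairs Incongruent (residues k)
    residues-distinct zero    _   = []
    residues-distinct (suc k) k<p =
      residues-below k (suc k) (ℕP.n<1+n k) k<p ∷ residues-distinct k (ℕP.<-trans (ℕP.n<1+n k) k<p)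

    NonRoot : ℕ → ℕ → Set
    NonRoot m g = 0 < g × g < p × ¬ ((+ g) ^ m ≡ 1ℤ ⟨mod p ⟩)

    search-non-root : ∀ m k → k < p →
                      All (IsRoot (unity-polynomial m)) (residues k) ⊎ Σ ℕ (NonRoot (suc m))
    search-non-root m zero    _   = inj₁ []
    search-non-root m (suc k) k<p with search-non-root m k (ℕP.<-trans (ℕP.n<1+n k) k<p)
                                     | ≡-mod? p ((+ suc k) ^ suc m) 1ℤ
    ... | inj₂ found | _         = inj₂ found
    ... | inj₁ roots | no  ¬root = inj₂ (suc k , s≤s z≤n , k<p , ¬root)
    ... | inj₁ roots | yes root  =
      inj₁ (≡-mod-trans (≡-mod-reflexive (eval-unity-polynomial m (+ suc k))) (∣⇒≡0-mod (divides-difference root))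
            ∷ roots)

    -- For 0 < m < p - 1 there is a unit g modulo p with g ^ m ≢ 1 (mod p),
    -- since x ^ m - 1 has at most m roots among 1, ..., m + 1.
    non-root : ∀ m → 0 < m → suc m < p → Σ ℤ λ g → ¬ (+ p ∣ℤ g) × ¬ (g ^ m ≡ 1ℤ ⟨mod p ⟩)
    non-root (suc m) _ m+1<p with search-non-root m (suc (suc m)) m+1<p
    ... | inj₂ (g , 0<g , g<p , gᵐ≢1) = + g , (λ p∣g → ℕD.>⇒∤ {{ℕ.>-nonZero 0<g}} g<p (∣ℤ⇒∣ p∣g)) , gᵐ≢1
    ... | inj₁ roots = contradiction roots
      (lagrange (unity-polynomial m) (residues (suc (suc m)))
         (subst₂ _<_ (sym (unity-polynomial-length m)) (sym (residues-length (suc (suc m)))) (ℕP.n<1+n (suc m)))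
         (residues-distinct (suc (suc m)) m+1<p))

module SpecialResidues where
  open import Data.Nat.Base as ℕ using (ℕ; suc; _≤_; _<_; s≤s; z≤n; _%_; _/_)
  import Data.Nat.Properties as ℕP
  open import Data.Nat.Divisibility as ℕD using (divides)
  open import Data.Nat.DivMod using (m≡m%n+[m/n]*n; m%n<n)
  open import Data.Nat.Primality using (Prime)
  open import Data.Nat.Coprimality using (coprime-divisor)
  open import Data.Nat.Tactic.RingSolver renaming (solve-∀ to solveℕ-∀)
  open import Data.Integer.Base using (ℤ; +_; -_; _+_; _-_; _*_; _^_; 0ℤ; 1ℤ; -1ℤ; ∣_∣)
  import Data.Integer.Properties as ℤP
  open import Data.Integer.Divisibility.Signed using (divides) renaming (_∣_ to _∣ℤ_)
  open import Data.Integer.Tactic.RingSolver using (solve-∀)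
  open import Data.Sum using (_⊎_; inj₁; inj₂)
  open import Data.Product using (Σ; _,_; _×_; proj₁; proj₂)
  open import Relation.Nullary using (¬_; contradiction)
  open import Relation.Binary.PropositionalEquality
  open Congruences
  open PowersPrimesFermat
  open RootsOfUnity
  open Lagrange

  div-mod-4 : ∀ p → p ≡ p % 4 ℕ.+ 4 ℕ.* (p / 4)
  div-mod-4 p = trans (m≡m%n+[m/n]*n p 4) (cong (p % 4 ℕ.+_) (ℕP.*-comm (p / 4) 4))

  %4≡1⇒≡1-mod-4 : ∀ {p} → p % 4 ≡ 1 → + p ≡ 1ℤ ⟨mod 4 ⟩
  %4≡1⇒≡1-mod-4 {p} p%4≡1 = subst (λ m → + m ≡ 1ℤ ⟨mod 4 ⟩) (sym p≡1+4j)
    (+-cong-mod (≡-mod-refl 1ℤ) (subst (λ m → + m ≡ 0ℤ ⟨mod 4 ⟩) (ℕP.*-comm (p / 4) 4) (multiple≡0-mod (p / 4) 4)))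
    where
    p≡1+4j : p ≡ 1 ℕ.+ 4 ℕ.* (p / 4)
    p≡1+4j = trans (div-mod-4 p) (cong (ℕ._+ 4 ℕ.* (p / 4)) p%4≡1)

  odd-mod-4 : ∀ p → ¬ 2 ℕD.∣ p → p % 4 ≡ 1 ⊎ p % 4 ≡ 3
  odd-mod-4 p 2∤p = remainder (p % 4) (m%n<n p 4) (div-mod-4 p)
    where
    j = p / 4
    remainder : ∀ r → r < 4 → p ≡ r ℕ.+ 4 ℕ.* j → r ≡ 1 ⊎ r ≡ 3
    remainder 0 _ p≡4j   = contradiction (divides (2 ℕ.* j) (trans p≡4j (identity₀ j))) 2∤p
      where
      identity₀ : ∀ j → 4 ℕ.* j ≡ 2 ℕ.* j ℕ.* 2
      identity₀ = solveℕ-∀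
    remainder 1 _ _      = inj₁ refl
    remainder 2 _ p≡2+4j = contradiction (divides (1 ℕ.+ 2 ℕ.* j) (trans p≡2+4j (identity₂ j))) 2∤p
      where
      identity₂ : ∀ j → 2 ℕ.+ 4 ℕ.* j ≡ (1 ℕ.+ 2 ℕ.* j) ℕ.* 2
      identity₂ = solveℕ-∀
    remainder 3 _ _      = inj₂ refl
    remainder (suc (suc (suc (suc _)))) (s≤s (s≤s (s≤s (s≤s ())))) _

  -- A prime p ≡ 3 (mod 4) admits no square root of -1: otherwise
  -- 1 ≡ y ^ (p - 1) = (y ^ 2) ^ ((p - 1) / 2) ≡ (-1) ^ odd = -1 (mod p).
  no-square-root-of-minus-one : ∀ {p} → Prime p → p % 4 ≡ 3 → ∀ y → ¬ (y * y ≡ -1ℤ ⟨mod p ⟩)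
  no-square-root-of-minus-one {p} pp p%4≡3 y y²≡-1 = 1≢-1-mod 2<p (begin
    1ℤ                          ≈⟨ fermat-unit pp y p∤y ⟨
    y ^ (p ℕ.∸ 1)               ≡⟨ cong (y ^_) p-1≡2[2j+1] ⟩
    y ^ (2 ℕ.* suc (2 ℕ.* j))   ≡⟨ ^-* y 2 (suc (2 ℕ.* j)) ⟩
    (y ^ 2) ^ suc (2 ℕ.* j)     ≈⟨ ^-cong-mod (suc (2 ℕ.* j)) (≡-mod-trans (≡-mod-reflexive (cong (y *_) (ℤP.*-identityʳ y))) y²≡-1) ⟩
    -1ℤ ^ suc (2 ℕ.* j)         ≡⟨ -1^odd j ⟩
    -1ℤ                         ∎)
    where
    open ≡-mod-Reasoning p
    j = p / 4
    p≡3+4j : p ≡ 3 ℕ.+ 4 ℕ.* j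
    p≡3+4j = trans (div-mod-4 p) (cong (ℕ._+ 4 ℕ.* j) p%4≡3)
    2<p : 2 < p
    2<p = subst (2 <_) (sym p≡3+4j) (s≤s (s≤s (s≤s z≤n)))
    p-1≡2[2j+1] : p ℕ.∸ 1 ≡ 2 ℕ.* suc (2 ℕ.* j)
    p-1≡2[2j+1] = trans (cong (ℕ._∸ 1) p≡3+4j) (identity j)
      where
      identity : ∀ j → 2 ℕ.+ 4 ℕ.* j ≡ 2 ℕ.* suc (2 ℕ.* j)
      identity = solveℕ-∀
    p∤y : ¬ + p ∣ℤ y
    p∤y p∣y = prime∤1 pp (∣ℤ⇒∣ (≡0-mod⇒∣ (begin
      -1ℤ        ≈⟨ y²≡-1 ⟨
      y * y      ≈⟨ *-cong-mod (∣⇒≡0-mod p∣y) (≡-mod-refl y) ⟩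
      0ℤ * y     ≡⟨ ℤP.*-zeroˡ y ⟩
      0ℤ         ∎)))

  cofactor-bounds : ∀ {p r m} → Prime p → Prime r → p ℕ.∸ 1 ≡ m ℕ.* r → 0 < m × suc m < p
  cofactor-bounds {suc p-1} {r} {m} pp pr p-1≡mr = 0<m , s≤s m<p-1
    where
    0<m : 0 < m
    0<m = ℕP.n≢0⇒n>0 λ m≡0 → ℕP.<⇒≱ (prime≥2 pp) (s≤s (ℕP.m∸n≡0⇒m≤n (trans p-1≡mr (cong (ℕ._* r) m≡0))))
    m<p-1 : m < p-1
    m<p-1 = subst (m <_) (sym p-1≡mr) (ℕP.m<m*n m r {{ℕ.>-nonZero 0<m}} (prime≥2 pr))

  -- For primes r ∣ p - 1 there is a c with c ^ r ≡ 1 (mod p ^ (e + 1)) and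
  -- c ≢ 1 (mod p): with p - 1 = m r, take a unit g with g ^ m ≢ 1 (mod p) and
  -- c = z ^ m for the lift z = g ^ (p ^ e) of g.
  element-of-prime-order : ∀ {p r} e → Prime p → Prime r → r ℕD.∣ p ℕ.∸ 1 →
                           Σ ℤ λ c → c ^ r ≡ 1ℤ ⟨mod p ℕ.^ suc e ⟩ × ¬ (c ≡ 1ℤ ⟨mod p ⟩)
  element-of-prime-order {p} {r} e pp pr (divides m p-1≡mr)
    with cofactor-bounds pp pr p-1≡mr
  ... | 0<m , m+1<p with non-root pp m 0<m m+1<p
  ...   | g , p∤g , gᵐ≢1 with teichmüller e pp g p∤g
  ...     | zᵖ⁻¹≡1 , z≡g = c , cʳ≡1 , c≢1
    where
    z = g ^ (p ℕ.^ e)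
    c = z ^ m
    cʳ≡1 : c ^ r ≡ 1ℤ ⟨mod p ℕ.^ suc e ⟩
    cʳ≡1 = subst (λ k → k ≡ 1ℤ ⟨mod p ℕ.^ suc e ⟩) (trans (cong (z ^_) p-1≡mr) (^-* z m r)) zᵖ⁻¹≡1
    c≢1 : ¬ (c ≡ 1ℤ ⟨mod p ⟩)
    c≢1 c≡1 = gᵐ≢1 (≡-mod-trans (^-cong-mod m (≡-mod-sym z≡g)) c≡1)

  -- Square roots of 1 modulo a prime power p ^ k other than 1 (mod p) are -1:
  -- p ^ k divides (u - 1)(u + 1) and is coprime to u - 1.
  square-root-of-one : ∀ {p} k → Prime p → ∀ u → u * u ≡ 1ℤ ⟨mod p ℕ.^ k ⟩ →
                       ¬ (u ≡ 1ℤ ⟨mod p ⟩) → u ≡ -1ℤ ⟨mod p ℕ.^ k ⟩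
  square-root-of-one {p} k pp u u²≡1 u≢1 =
    mkCong (subst (+ (p ℕ.^ k) ∣ℤ_) (shift u) (∣⇒∣ℤ (coprime-divisor coprime pᵏ∣product)))
    where
    factor : ∀ u → u * u - 1ℤ ≡ (u - 1ℤ) * (u + 1ℤ)
    factor = solve-∀
    shift : ∀ u → u + 1ℤ ≡ u - -1ℤ
    shift = solve-∀
    coprime = coprime-prime-power k pp (λ p∣u-1 → u≢1 (mkCong (∣⇒∣ℤ p∣u-1)))
    pᵏ∣product : p ℕ.^ k ℕD.∣ ∣ u - 1ℤ ∣ ℕ.* ∣ u + 1ℤ ∣
    pᵏ∣product = subst (p ℕ.^ k ℕD.∣_) (trans (cong ∣_∣ (factor u)) (ℤP.abs-* (u - 1ℤ) (u + 1ℤ)))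
                   (∣ℤ⇒∣ (divides-difference u²≡1))

  quarter : ∀ {p} → Prime p → p % 4 ≡ 1 → p ≡ suc (2 ℕ.* (2 ℕ.* (p / 4))) × 0 < p / 4
  quarter {p} pp p%4≡1 = trans p≡1+4j (cong suc (quadruple j)) , 0<j
    where
    j = p / 4
    p≡1+4j : p ≡ 1 ℕ.+ 4 ℕ.* j
    p≡1+4j = trans (div-mod-4 p) (cong (ℕ._+ 4 ℕ.* j) p%4≡1)
    quadruple : ∀ j → 4 ℕ.* j ≡ 2 ℕ.* (2 ℕ.* j)
    quadruple = solveℕ-∀
    0<j : 0 < j
    0<j = ℕP.n≢0⇒n>0 λ j≡0 → ℕP.<⇒≢ (prime≥2 pp) (sym (trans p≡1+4j (cong (λ k → 1 ℕ.+ 4 ℕ.* k) j≡0)))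

  -- For a prime p = 4 j + 1 some unit g has g ^ (2 j) ≡ -1 (mod p): take g with
  -- y = g ^ (2 j) ≢ 1; as y ^ 2 = g ^ (p - 1) ≡ 1, y ≡ -1.
  half-power≡-1 : ∀ {p} → Prime p → p % 4 ≡ 1 → Σ ℤ λ g → ¬ + p ∣ℤ g × g ^ (2 ℕ.* (p / 4)) ≡ -1ℤ ⟨mod p ⟩
  half-power≡-1 {p} pp p%4≡1 with quarter pp p%4≡1
  ... | p≡4j+1 , 0<j with non-root pp (2 ℕ.* j) 0<2j 2j+1<p
    where
    j = p / 4
    0<2j : 0 < 2 ℕ.* j
    0<2j = ℕP.<-≤-trans 0<j (ℕP.m≤m+n j (j ℕ.+ 0))
    2j<4j : 2 ℕ.* j < 2 ℕ.* (2 ℕ.* j)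
    2j<4j = subst (2 ℕ.* j <_) (cong (2 ℕ.* j ℕ.+_) (sym (ℕP.+-identityʳ (2 ℕ.* j)))) (ℕP.m<m+n (2 ℕ.* j) 0<2j)
    2j+1<p : suc (2 ℕ.* j) < p
    2j+1<p = subst (suc (2 ℕ.* j) <_) (sym p≡4j+1) (s≤s 2j<4j)
  ...   | g , p∤g , y≢1 = g , p∤g , y≡-1
    where
    j = p / 4
    p-1≡4j : p ℕ.∸ 1 ≡ 2 ℕ.* (2 ℕ.* j)
    p-1≡4j = cong (ℕ._∸ 1) p≡4j+1
    y = g ^ (2 ℕ.* j)
    y²≡1 : y * y ≡ 1ℤ ⟨mod p ℕ.* 1 ⟩
    y²≡1 = subst (λ k → y * y ≡ 1ℤ ⟨mod k ⟩) (sym (ℕP.*-identityʳ p)) (begin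
      y * y                   ≡⟨ square-of-power g (2 ℕ.* j) ⟩
      g ^ (2 ℕ.* (2 ℕ.* j))   ≡⟨ cong (g ^_) p-1≡4j ⟨
      g ^ (p ℕ.∸ 1)           ≈⟨ fermat-unit pp g p∤g ⟩
      1ℤ                      ∎)
      where open ≡-mod-Reasoning p
    y≡-1 : y ≡ -1ℤ ⟨mod p ⟩
    y≡-1 = subst (λ k → y ≡ -1ℤ ⟨mod k ⟩) (ℕP.*-identityʳ p) (square-root-of-one 1 pp y y²≡1 y≢1)

  -- For a prime p ≡ 1 (mod 4) and every e, -1 has a square root modulo p ^ (e + 1):
  -- with p - 1 = 4 j and g as above, lift z = g ^ (p ^ e) and take t = z ^ j.
  -- Then u = t ^ 2 satisfies u ^ 2 = z ^ (p - 1) ≡ 1 (mod p ^ (e + 1)) and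
  -- u ≡ g ^ (2 j) ≡ -1 ≢ 1 (mod p), so u ≡ -1 (mod p ^ (e + 1)).
  square-root-of-minus-one : ∀ {p} e → Prime p → p % 4 ≡ 1 → Σ ℤ λ t → t * t ≡ -1ℤ ⟨mod p ℕ.^ suc e ⟩
  square-root-of-minus-one {p} e pp p%4≡1 = t , square-root-of-one (suc e) pp (t * t) u²≡1 u≢1
    where
    j = p / 4
    root = half-power≡-1 pp p%4≡1
    g = proj₁ root
    lift = teichmüller e pp g (proj₁ (proj₂ root))
    p≡4j+1 : p ≡ suc (2 ℕ.* (2 ℕ.* j))
    p≡4j+1 = proj₁ (quarter pp p%4≡1)
    0<j : 0 < j
    0<j = proj₂ (quarter pp p%4≡1)
    2<p : 2 < p
    2<p = subst (2 <_) (sym p≡4j+1) (s≤s (ℕP.≤-trans (s≤s (s≤s z≤n)) (ℕP.*-monoʳ-≤ 2 (ℕP.*-monoʳ-≤ 2 0<j))))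
    z = g ^ (p ℕ.^ e)
    t = z ^ j
    u²≡1 : (t * t) * (t * t) ≡ 1ℤ ⟨mod p ℕ.^ suc e ⟩
    u²≡1 = subst (λ k → k ≡ 1ℤ ⟨mod p ℕ.^ suc e ⟩) (sym u²≡zᵖ⁻¹) (proj₁ lift)
      where
      u²≡zᵖ⁻¹ : (t * t) * (t * t) ≡ z ^ (p ℕ.∸ 1)
      u²≡zᵖ⁻¹ = begin
        (t * t) * (t * t)                  ≡⟨ cong (λ u → u * u) (square-of-power z j) ⟩
        z ^ (2 ℕ.* j) * z ^ (2 ℕ.* j)      ≡⟨ square-of-power z (2 ℕ.* j) ⟩
        z ^ (2 ℕ.* (2 ℕ.* j))              ≡⟨ cong (λ k → z ^ (k ℕ.∸ 1)) p≡4j+1 ⟨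
        z ^ (p ℕ.∸ 1)                      ∎
        where open ≡-Reasoning
    u≡-1 : t * t ≡ -1ℤ ⟨mod p ⟩
    u≡-1 = ≡-mod-trans (≡-mod-reflexive (square-of-power z j)) (≡-mod-trans (^-cong-mod (2 ℕ.* j) (proj₂ lift)) (proj₂ (proj₂ root)))
    u≢1 : ¬ (t * t ≡ 1ℤ ⟨mod p ⟩)
    u≢1 u≡1 = 1≢-1-mod 2<p (≡-mod-trans (≡-mod-sym u≡1) u≡-1)

module OddPartsAndFactorisation where
  open import Data.Nat.Base as ℕ using (ℕ; zero; suc; _≤_; _<_; s≤s; z≤n; _%_; ⌊_/2⌋)
  import Data.Nat.Properties as ℕP
  open import Data.Nat.Divisibility as ℕD using (divides)
  open import Data.Nat.Primality using (Prime; prime[2]; euclidsLemma)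
  open import Data.Nat.GCD using (gcd; gcd[m,n]∣m; gcd[m,n]∣n; gcd-greatest)
  open import Data.Nat.Tactic.RingSolver renaming (solve-∀ to solveℕ-∀)
  open import Data.Sum using (_⊎_; inj₁; inj₂)
  open import Data.Product using (Σ; _,_; _×_; proj₁; proj₂)
  open import Relation.Nullary using (¬_; yes; no; contradiction)
  open import Data.Nat.Induction using (<-rec)
  open import Relation.Binary.PropositionalEquality
  open import Function.Base using (_∘′_)
  open import Defs using (oddPartAux; val2Aux; oddPart; val2; dash)
  open PowersPrimesFermat

  private
    double-suc : ∀ h → 2 ℕ.* suc h ≡ suc (suc (2 ℕ.* h))
    double-suc = solveℕ-∀

  parity : ∀ n → (n % 2 ≡ 0 × n ≡ 2 ℕ.* ⌊ n /2⌋) ⊎ (n % 2 ≡ 1 × n ≡ suc (2 ℕ.* ⌊ n /2⌋))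
  parity zero          = inj₁ (refl , refl)
  parity (suc zero)    = inj₂ (refl , refl)
  parity (suc (suc n)) with parity n
  ... | inj₁ (n%2≡0 , n≡2h)   = inj₁ (n%2≡0 , trans (cong (suc ∘′ suc) n≡2h) (sym (double-suc ⌊ n /2⌋)))
  ... | inj₂ (n%2≡1 , n≡2h+1) = inj₂ (n%2≡1 , cong suc (trans (cong suc n≡2h+1) (sym (double-suc ⌊ n /2⌋))))

  %2≡1⇒odd : ∀ n → n % 2 ≡ 1 → ¬ 2 ℕD.∣ n
  %2≡1⇒odd n n%2≡1 2∣n with trans (sym n%2≡1) (ℕD.n∣m⇒m%n≡0 n 2 2∣n)
  ... | ()

  %2≡1⇒form : ∀ n → n % 2 ≡ 1 → Σ ℕ λ k → n ≡ suc (2 ℕ.* k)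
  %2≡1⇒form n n%2≡1 with parity n
  ... | inj₁ (n%2≡0 , _)  with trans (sym n%2≡1) n%2≡0
  ...   | ()
  %2≡1⇒form n n%2≡1 | inj₂ (_ , n≡2h+1) = ⌊ n /2⌋ , n≡2h+1

  odd⇒2∣pred : ∀ n → ¬ 2 ℕD.∣ n → 2 ℕD.∣ n ℕ.∸ 1
  odd⇒2∣pred n 2∤n with parity n
  ... | inj₁ (_ , n≡2h) = contradiction (divides ⌊ n /2⌋ (trans n≡2h (ℕP.*-comm 2 ⌊ n /2⌋))) 2∤n
  ... | inj₂ (_ , n≡2h+1) = divides ⌊ n /2⌋ (trans (cong (ℕ._∸ 1) n≡2h+1) (ℕP.*-comm 2 ⌊ n /2⌋))

  private
    oddPart-even : ∀ f m → suc m % 2 ≡ 0 → oddPartAux (suc f) (suc m) ≡ oddPartAux f ⌊ suc m /2⌋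
    oddPart-even f m even rewrite even = refl

    oddPart-odd : ∀ f m → suc m % 2 ≡ 1 → oddPartAux (suc f) (suc m) ≡ suc m
    oddPart-odd f m odd rewrite odd = refl

    val2-even : ∀ f m → suc m % 2 ≡ 0 → val2Aux (suc f) (suc m) ≡ suc (val2Aux f ⌊ suc m /2⌋)
    val2-even f m even rewrite even = refl

    val2-odd : ∀ f m → suc m % 2 ≡ 1 → val2Aux (suc f) (suc m) ≡ 0
    val2-odd f m odd rewrite odd = refl

    TwoAdic : ℕ → ℕ → ℕ → Set
    TwoAdic m v o = m ≡ 2 ℕ.^ v ℕ.* o × o % 2 ≡ 1

    two-adic-fuelled : ∀ f m → 0 < m → m ≤ f → TwoAdic m (val2Aux f m) (oddPartAux f m)
    two-adic-fuelled zero    m       0<m m≤0 = contradiction (ℕP.<-≤-trans 0<m m≤0) (λ ())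
    two-adic-fuelled (suc f) (suc m) _   m≤f with parity (suc m)
    ... | inj₂ (odd , _) = subst₂ (TwoAdic (suc m)) (sym (val2-odd f m odd)) (sym (oddPart-odd f m odd))
                             (sym (ℕP.*-identityˡ (suc m)) , odd)
    ... | inj₁ (even , m≡2h) with two-adic-fuelled f ⌊ suc m /2⌋ 0<h h≤f
      where
      0<h : 0 < ⌊ suc m /2⌋
      0<h = ℕP.n≢0⇒n>0 λ h≡0 → ℕP.1+n≢0 (trans m≡2h (cong (2 ℕ.*_) h≡0))
      h≤f : ⌊ suc m /2⌋ ≤ f
      h≤f = ℕP.≤-pred (ℕP.<-≤-trans (ℕP.⌊n/2⌋<n m) m≤f)
    ...   | h≡2ᵛo , odd = subst₂ (TwoAdic (suc m)) (sym (val2-even f m even)) (sym (oddPart-even f m even))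
                            (trans m≡2h (trans (cong (2 ℕ.*_) h≡2ᵛo) (sym (ℕP.*-assoc 2 (2 ℕ.^ val2Aux f ⌊ suc m /2⌋) (oddPartAux f ⌊ suc m /2⌋)))) , odd)

  two-adic : ∀ m → 0 < m → m ≡ 2 ℕ.^ val2 m ℕ.* oddPart m × oddPart m % 2 ≡ 1
  two-adic m 0<m = two-adic-fuelled m m 0<m ℕP.≤-refl

  dash-decomposition : ∀ m → 1 < m → m ℕ.∸ 1 ≡ 2 ℕ.^ val2 (m ℕ.∸ 1) ℕ.* dash m × dash m % 2 ≡ 1
  dash-decomposition (suc (suc m)) _ = two-adic (suc m) (s≤s z≤n)
  dash-decomposition (suc zero) (s≤s ())

  dash∣pred : ∀ m → 1 < m → dash m ℕD.∣ m ℕ.∸ 1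
  dash∣pred m 1<m = divides (2 ℕ.^ val2 (m ℕ.∸ 1)) (proj₁ (dash-decomposition m 1<m))

  dash-odd : ∀ m → 1 < m → ¬ 2 ℕD.∣ dash m
  dash-odd m 1<m = %2≡1⇒odd (dash m) (proj₂ (dash-decomposition m 1<m))

  odd-prime∣dash : ∀ {r} m → 1 < m → Prime r → ¬ 2 ℕD.∣ r → r ℕD.∣ m ℕ.∸ 1 → r ℕD.∣ dash m
  odd-prime∣dash {r} m 1<m pr 2∤r r∣m-1
    with euclidsLemma (2 ℕ.^ val2 (m ℕ.∸ 1)) (dash m) pr (subst (r ℕD.∣_) (proj₁ (dash-decomposition m 1<m)) r∣m-1)
  ... | inj₂ r∣dash = r∣dash
  ... | inj₁ r∣2ᵏ with prime∣prime-power (val2 (m ℕ.∸ 1)) prime[2] pr r∣2ᵏ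
  ...   | refl = contradiction ℕD.∣-refl 2∤r

  val2-positive : ∀ m → 1 < m → ¬ 2 ℕD.∣ m → 0 < val2 (m ℕ.∸ 1)
  val2-positive m 1<m 2∤m with val2 (m ℕ.∸ 1) | proj₁ (dash-decomposition m 1<m)
  ... | zero  | m-1≡m' = contradiction (subst (2 ℕD.∣_) (trans m-1≡m' (ℕP.*-identityˡ (dash m))) (odd⇒2∣pred m 2∤m))
                                       (dash-odd m 1<m)
  ... | suc _ | _ = s≤s z≤n

  val2>1 : ∀ m → 1 < m → 4 ℕD.∣ m ℕ.∸ 1 → 1 < val2 (m ℕ.∸ 1)
  val2>1 m 1<m 4∣m-1 with val2 (m ℕ.∸ 1) | proj₁ (dash-decomposition m 1<m)
  ... | zero | m-1≡m' =
    contradiction (ℕD.∣-trans (divides 2 refl) (subst (4 ℕD.∣_) (trans m-1≡m' (ℕP.*-identityˡ (dash m))) 4∣m-1))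
                  (dash-odd m 1<m)
  ... | suc zero | m-1≡2m' = contradiction (ℕD.*-cancelˡ-∣ 2 (subst (2 ℕ.* 2 ℕD.∣_) m-1≡2m' 4∣m-1)) (dash-odd m 1<m)
  ... | suc (suc _) | _ = s≤s (s≤s z≤n)

  common-odd-prime : ∀ a b → ¬ 2 ℕD.∣ a → gcd a b ≢ 1 →
                     Σ ℕ λ r → Prime r × ¬ 2 ℕD.∣ r × r ℕD.∣ a × r ℕD.∣ b
  common-odd-prime a b 2∤a gcd≢1 with gcd a b | gcd[m,n]∣m a b | gcd[m,n]∣n a b
  ... | zero        | 0∣a | _ = contradiction (subst (2 ℕD.∣_) (sym (ℕD.0∣⇒≡0 0∣a)) (ℕD._∣0 2)) 2∤a
  ... | suc zero    | _   | _ = contradiction refl gcd≢1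
  ... | g@(suc (suc _)) | g∣a | g∣b with prime-divisor g (s≤s (s≤s z≤n))
  ...   | r , pr , r∣g = r , pr , (λ 2∣r → 2∤a (ℕD.∣-trans 2∣r r∣a)) , r∣a , ℕD.∣-trans r∣g g∣b
    where
    r∣a = ℕD.∣-trans r∣g g∣a

  common-prime⇒gcd≢1 : ∀ {r} a b → Prime r → r ℕD.∣ a → r ℕD.∣ b → gcd a b ≢ 1
  common-prime⇒gcd≢1 a b pr r∣a r∣b gcd≡1 = prime∤1 pr (subst (_ ℕD.∣_) gcd≡1 (gcd-greatest r∣a r∣b))

  pred-product : ∀ p q → 0 < p → 0 < q → q ℕ.* p ℕ.∸ 1 ≡ q ℕ.* (p ℕ.∸ 1) ℕ.+ (q ℕ.∸ 1)
  pred-product (suc p-1) (suc q-1) _ _ = identity p-1 q-1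
    where
    identity : ∀ p-1 q-1 → p-1 ℕ.+ q-1 ℕ.* suc p-1 ≡ suc q-1 ℕ.* p-1 ℕ.+ q-1
    identity = solveℕ-∀

  ∣pred-factor⇒∣pred : ∀ {r} p q → 0 < p → 0 < q → r ℕD.∣ p ℕ.∸ 1 → r ℕD.∣ q ℕ.∸ 1 → r ℕD.∣ q ℕ.* p ℕ.∸ 1
  ∣pred-factor⇒∣pred {r} p q 0<p 0<q r∣p-1 r∣q-1 =
    subst (r ℕD.∣_) (sym (pred-product p q 0<p 0<q)) (ℕD.∣m∣n⇒∣m+n (ℕD.∣n⇒∣m*n q r∣p-1) r∣q-1)

  ∣pred⇒∣pred-cofactor : ∀ {r} p q → 0 < p → 0 < q → r ℕD.∣ p ℕ.∸ 1 → r ℕD.∣ q ℕ.* p ℕ.∸ 1 → r ℕD.∣ q ℕ.∸ 1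
  ∣pred⇒∣pred-cofactor {r} p q 0<p 0<q r∣p-1 r∣n-1 =
    ℕD.∣m+n∣m⇒∣n (subst (r ℕD.∣_) (pred-product p q 0<p 0<q) r∣n-1) (ℕD.∣n⇒∣m*n q r∣p-1)

  split-prime-power : ∀ {p} → Prime p → ∀ N → 0 < N → Σ ℕ λ e → Σ ℕ λ M → N ≡ p ℕ.^ e ℕ.* M × ¬ p ℕD.∣ M
  split-prime-power {p} pp = <-rec Splits split
    where
    Splits : ℕ → Set
    Splits N = 0 < N → Σ ℕ λ e → Σ ℕ λ M → N ≡ p ℕ.^ e ℕ.* M × ¬ p ℕD.∣ M
    split : ∀ N → (∀ {k} → k < N → Splits k) → Splits N
    split N rec 0<N with p ℕD.∣? N
    ... | no p∤N = 0 , N , sym (ℕP.+-identityʳ N) , p∤N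
    ... | yes (divides k N≡kp) with rec k<N 0<k
      where
      0<k : 0 < k
      0<k = ℕP.n≢0⇒n>0 λ k≡0 → ℕP.<⇒≢ 0<N (sym (trans N≡kp (cong (ℕ._* p) k≡0)))
      k<N : k < N
      k<N = subst (k <_) (sym N≡kp) (ℕP.m<m*n k p {{ℕ.>-nonZero 0<k}} (prime≥2 pp))
    ...   | e , M , k≡pᵉM , p∤M = suc e , M , N≡pᵉ⁺¹M , p∤M
      where
      N≡pᵉ⁺¹M : N ≡ p ℕ.* p ℕ.^ e ℕ.* M
      N≡pᵉ⁺¹M = begin
        N                         ≡⟨ N≡kp ⟩
        k ℕ.* p                   ≡⟨ cong (ℕ._* p) k≡pᵉM ⟩
        p ℕ.^ e ℕ.* M ℕ.* p       ≡⟨ ℕP.*-comm (p ℕ.^ e ℕ.* M) p ⟩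
        p ℕ.* (p ℕ.^ e ℕ.* M)     ≡⟨ ℕP.*-assoc p (p ℕ.^ e) M ⟨
        p ℕ.* p ℕ.^ e ℕ.* M       ∎
        where open ≡-Reasoning

  split-prime-power-∣ : ∀ {p N} → Prime p → p ℕD.∣ N → 0 < N →
                        Σ ℕ λ e → Σ ℕ λ M → N ≡ p ℕ.^ suc e ℕ.* M × ¬ p ℕD.∣ M
  split-prime-power-∣ {p} {N} pp p∣N 0<N with split-prime-power pp N 0<N
  ... | zero  , M , N≡M    , p∤M = contradiction (subst (p ℕD.∣_) (trans N≡M (ℕP.*-identityˡ M)) p∣N) p∤M
  ... | suc e , M , N≡pᵉM , p∤M = e , M , N≡pᵉM , p∤M

  prime-power-induction : (P : ℕ → Set) → P 1 →
                          (∀ {p} e M → Prime p → ¬ p ℕD.∣ M → P M → P (p ℕ.^ suc e ℕ.* M)) →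
                          ∀ N → 0 < N → P N
  prime-power-induction P base step = <-rec (λ N → 0 < N → P N) induct
    where
    induct : ∀ N → (∀ {k} → k < N → 0 < k → P k) → 0 < N → P N
    induct (suc zero) _ _ = base
    induct N@(suc (suc _)) rec 0<N with prime-divisor N (s≤s (s≤s z≤n))
    ... | p , pp , p∣N with split-prime-power-∣ pp p∣N 0<N
    ...   | e , M , N≡pᵉ⁺¹M , p∤M = subst P (sym N≡pᵉ⁺¹M) (step e M pp p∤M (rec M<N 0<M))
      where
      A = p ℕ.^ suc e
      0<M : 0 < M
      0<M = ℕP.n≢0⇒n>0 λ M≡0 → ℕP.<⇒≢ 0<N (sym (trans N≡pᵉ⁺¹M (trans (cong (A ℕ.*_) M≡0) (ℕP.*-zeroʳ A))))
      M<N : M < N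
      M<N = subst (M <_) (trans (ℕP.*-comm M A) (sym N≡pᵉ⁺¹M))
              (ℕP.m<m*n M A {{ℕ.>-nonZero 0<M}} (ℕP.^-monoʳ-< p (prime≥2 pp) {0} {suc e} (s≤s z≤n)))

module StrongLiars where
  open import Data.Nat.Base as ℕ using (ℕ; zero; suc; _≤_; _<_; s≤s; z≤n; _%_)
  import Data.Nat.Properties as ℕP
  open import Data.Nat.Primality using (Prime; Composite; composite⇒nonTrivial; composite⇒¬prime; prime?)
  open import Relation.Nullary.Decidable using (_×-dec_)
  open import Data.Nat.Coprimality using (Coprime; gcd≡1⇒coprime)
  open import Data.Nat.Divisibility as ℕD using (divides)
  open import Data.Nat.GCD using (gcd)
  open import Data.Integer.Divisibility.Signed using (divides)
  open import Data.Integer.Base as ℤ using (ℤ; +_; -_; _+_; _-_; _*_; _^_; 0ℤ; 1ℤ; -1ℤ)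
  import Data.Integer.Properties as ℤP
  open import Data.Fin.Base using (Fin; toℕ; fromℕ<)
  open import Data.Fin.Properties using (toℕ-fromℕ<; toℕ<n; toℕ-injective; any?)
  open import Data.Sum using (_⊎_; inj₁; inj₂)
  open import Data.Product using (Σ; _,_; _×_; proj₁; proj₂)
  open import Relation.Nullary using (¬_; yes; no; contradiction)
  open import Data.Empty using (⊥)
  open import Relation.Binary.PropositionalEquality
  open import Defs using (dash; StrongLiar; S; HasExactlyTwo; _≡_[mod_])
  open Congruences
  open PowersPrimesFermat
  open RootsOfUnity
  open SpecialResidues
  open OddPartsAndFactorisation

  odd>1⇒>2 : ∀ n → 1 < n → ¬ 2 ℕD.∣ n → 2 < n
  odd>1⇒>2 (suc zero)          (s≤s ()) _
  odd>1⇒>2 (suc (suc zero))    _ 2∤2 = contradiction ℕD.∣-refl 2∤2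
  odd>1⇒>2 (suc (suc (suc _))) _ _   = s≤s (s≤s (s≤s z≤n))

  pred≡-1 : ∀ n → 0 < n → + (n ℕ.∸ 1) ≡ -1ℤ ⟨mod n ⟩
  pred≡-1 (suc m) _ = mkCong (divides 1ℤ (cong +_ (trans (ℕP.+-comm m 1) (sym (ℕP.+-identityʳ (suc m))))))

  no-third-element : ∀ {A : Set} {P : A → Set} → HasExactlyTwo P → ∀ {x y z} →
                     P x → P y → P z → x ≢ y → z ≢ x → z ≢ y → ⊥
  no-third-element (a , b , _ , _ , _ , only) {x} {y} {z} Px Py Pz x≢y z≢x z≢y
    with only x Px | only y Py | only z Pz
  ... | inj₁ refl | inj₁ refl | _         = x≢y refl
  ... | inj₂ refl | inj₂ refl | _         = x≢y refl
  ... | inj₁ refl | _         | inj₁ refl = z≢x refl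
  ... | inj₂ refl | _         | inj₂ refl = z≢x refl
  ... | _         | inj₁ refl | inj₁ refl = z≢y refl
  ... | _         | inj₂ refl | inj₂ refl = z≢y refl

  module OddComposite (n : ℕ) (2∤n : ¬ 2 ℕD.∣ n) (composite : Composite n) where

    1<n : 1 < n
    1<n = ℕ.nonTrivial⇒n>1 n {{composite⇒nonTrivial composite}}

    0<n : 0 < n
    0<n = ℕP.<-trans (s≤s z≤n) 1<n

    2<n : 2 < n
    2<n = odd>1⇒>2 n 1<n 2∤n

    n' : ℕ
    n' = dash n

    n'-odd : Σ ℕ λ k → n' ≡ suc (2 ℕ.* k)
    n'-odd = %2≡1⇒form n' (proj₂ (dash-decomposition n 1<n))

    0<n' : 0 < n'
    0<n' = subst (0 <_) (sym (proj₂ n'-odd)) (s≤s z≤n)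

    -1^n' : -1ℤ ^ n' ≡ -1ℤ
    -1^n' = trans (cong (-1ℤ ^_) (proj₂ n'-odd)) (-1^odd (proj₁ n'-odd))

    neg-^n' : ∀ x → (- x) ^ n' ≡ - (x ^ n')
    neg-^n' x with n' | n'-odd
    ... | _ | k , refl = neg-^-odd x k

    -- No prime divisor of n divides n - 1, hence none divides n'.
    prime∣n⇒∤n' : ∀ {p} → Prime p → p ℕD.∣ n → ¬ p ℕD.∣ n'
    prime∣n⇒∤n' {p} pp p∣n p∣n' = prime∤1 pp (ℕD.∣m+n∣m⇒∣n (subst (p ℕD.∣_) n≡[n-1]+1 p∣n)
                                                          (ℕD.∣-trans p∣n' (dash∣pred n 1<n)))
      where
      n≡[n-1]+1 : n ≡ n ℕ.∸ 1 ℕ.+ 1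
      n≡[n-1]+1 = sym (ℕP.m∸n+n≡m 0<n)

    cofactor>1 : ∀ p q → Prime p → n ≡ q ℕ.* p → 1 < q
    cofactor>1 p zero          pp n≡0  = contradiction (sym n≡0) (ℕP.<⇒≢ 0<n)
    cofactor>1 p (suc zero)    pp n≡p  = contradiction (subst Prime (sym (trans n≡p (ℕP.+-identityʳ p))) pp)
                                                       (composite⇒¬prime composite)
    cofactor>1 p (suc (suc _)) pp _    = s≤s (s≤s z≤n)

    n-1<n : n ℕ.∸ 1 < n
    n-1<n = ℕP.∸-monoʳ-< {n} {1} {0} (s≤s z≤n) 0<n

    one minus-one : Fin n
    one       = fromℕ< 1<n
    minus-one = fromℕ< n-1<n

    one≢minus-one : one ≢ minus-one
    one≢minus-one one≡minus-one = ℕP.<⇒≢ (ℕP.<-≤-trans (s≤s (s≤s z≤n)) (ℕP.∸-monoˡ-≤ 1 2<n))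
      (trans (sym (toℕ-fromℕ< 1<n)) (trans (cong toℕ one≡minus-one) (toℕ-fromℕ< n-1<n)))

    n-1≡-1 : + (n ℕ.∸ 1) ≡ -1ℤ ⟨mod n ⟩
    n-1≡-1 = pred≡-1 n 0<n

    liar-residue : ∀ {a} (a<n : a < n) → StrongLiar n a → S n (fromℕ< a<n)
    liar-residue a<n = subst (StrongLiar n) (sym (toℕ-fromℕ< a<n))

    liar-one : S n one
    liar-one = liar-residue 1<n (inj₁ (toStatementCong (≡-mod-reflexive (cong +_ (ℕP.^-zeroˡ n')))))

    liar-minus-one : S n minus-one
    liar-minus-one = liar-residue n-1<n (inj₂ (0 , val2-positive n 1<n 2∤n , toStatementCong (begin
      + ((n ℕ.∸ 1) ℕ.^ (1 ℕ.* n'))    ≡⟨ cong (λ k → + ((n ℕ.∸ 1) ℕ.^ k)) (ℕP.*-identityˡ n') ⟩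
      + ((n ℕ.∸ 1) ℕ.^ n')            ≡⟨ pos-^ (n ℕ.∸ 1) n' ⟩
      (+ (n ℕ.∸ 1)) ^ n'              ≈⟨ ^-cong-mod n' n-1≡-1 ⟩
      -1ℤ ^ n'                        ≡⟨ -1^n' ⟩
      -1ℤ                             ∎)))
      where open ≡-mod-Reasoning n

    residue-≡ : ∀ (c : Fin n) {m} (m<n : m < n) → + toℕ c ≡ + m ⟨mod n ⟩ → c ≡ fromℕ< m<n
    residue-≡ c m<n c≡m = toℕ-injective (trans (residue-unique (toℕ<n c) m<n c≡m) (sym (toℕ-fromℕ< m<n)))

    DashesCoprime : Set
    DashesCoprime = (p q : ℕ) → Prime p → n ≡ q ℕ.* p → gcd (dash p) (dash q) ≡ 1

    -- Condition (2) makes n' prime to p - 1 for every prime p ∣ n = q p: a common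
    -- odd prime r of n' and p - 1 divides n - 1, hence q - 1, hence p' and q'.
    n'-coprime-pred : DashesCoprime → ∀ p → Prime p → p ℕD.∣ n → Coprime n' (p ℕ.∸ 1)
    n'-coprime-pred dashes-coprime p pp (divides q n≡qp) with gcd n' (p ℕ.∸ 1) ℕP.≟ 1
    ... | yes gcd≡1 = gcd≡1⇒coprime gcd≡1
    ... | no  gcd≢1 with common-odd-prime n' (p ℕ.∸ 1) (dash-odd n 1<n) gcd≢1
    ...   | r , pr , 2∤r , r∣n' , r∣p-1 =
      contradiction (dashes-coprime p q pp n≡qp) (common-prime⇒gcd≢1 (dash p) (dash q) pr r∣p' r∣q')
      where
      1<q = cofactor>1 p q pp n≡qp
      r∣n-1 : r ℕD.∣ q ℕ.* p ℕ.∸ 1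
      r∣n-1 = subst (λ m → r ℕD.∣ m ℕ.∸ 1) n≡qp (ℕD.∣-trans r∣n' (dash∣pred n 1<n))
      r∣q-1 : r ℕD.∣ q ℕ.∸ 1
      r∣q-1 = ∣pred⇒∣pred-cofactor p q (ℕP.<-trans (s≤s z≤n) (prime≥2 pp)) (ℕP.<-trans (s≤s z≤n) 1<q) r∣p-1 r∣n-1
      r∣p' = odd-prime∣dash p (prime≥2 pp) pr 2∤r r∣p-1
      r∣q' = odd-prime∣dash q 1<q pr 2∤r r∣q-1

    -- Modulo a
    -- prime power p ^ (e + 1) ∣ n: x ≡ 1 (mod p) as x ^ n' ≡ x ^ (p - 1) ≡ 1 with
    -- n' and p - 1 coprime, and the congruence lifts to p ^ (e + 1) as p ∤ n'.
    n'-root⇒1 : DashesCoprime → ∀ x → x ^ n' ≡ 1ℤ ⟨mod n ⟩ → x ≡ 1ℤ ⟨mod n ⟩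
    n'-root⇒1 dashes-coprime x xⁿ'≡1 =
      prime-power-induction (λ N → N ℕD.∣ n → x ≡ 1ℤ ⟨mod N ⟩) (λ _ → ≡-mod-1 x 1ℤ) step n 0<n ℕD.∣-refl
      where
      step : ∀ {p} e M → Prime p → ¬ p ℕD.∣ M → (M ℕD.∣ n → x ≡ 1ℤ ⟨mod M ⟩) →
             p ℕ.^ suc e ℕ.* M ℕD.∣ n → x ≡ 1ℤ ⟨mod p ℕ.^ suc e ℕ.* M ⟩
      step {p} e M pp p∤M x≡1[M] N∣n = ≡-mod-combine (coprime-prime-power (suc e) pp p∤M) x≡1[pᵉ⁺¹]
                                                      (x≡1[M] (ℕD.∣-trans (ℕD.n∣m*n (p ℕ.^ suc e)) N∣n))
        where
        pᵉ⁺¹∣n = ℕD.∣-trans (ℕD.m∣m*n M) N∣n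
        p∣n = ℕD.∣-trans (ℕD.m∣m*n (p ℕ.^ e)) pᵉ⁺¹∣n
        xⁿ'≡1[p] = ≡-mod-divisor p∣n xⁿ'≡1
        p∤x = root-of-unity-unit pp 0<n' xⁿ'≡1[p]
        x≡1[p] = root-of-unity-coprime n' (p ℕ.∸ 1) (n'-coprime-pred dashes-coprime p pp p∣n)
                   xⁿ'≡1[p] (fermat-unit pp x p∤x)
        x≡1[pᵉ⁺¹] = root-of-unity-mod-prime-power x n' (suc e) pp (prime∣n⇒∤n' pp p∣n) x≡1[p]
                      (≡-mod-divisor pᵉ⁺¹∣n xⁿ'≡1)

    liar-power : ∀ a k {y} → + (a ℕ.^ k) ≡ y [mod n ] → (+ a) ^ k ≡ y ⟨mod n ⟩
    liar-power a k h = ≡-mod-trans (≡-mod-reflexive (sym (pos-^ a k))) (fromStatementCong h)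

    -- If moreover some prime p₀ ≡ 3 (mod 4) divides n, the only strong liars are ±1:
    --   a ^ n' ≡ 1 gives a ≡ 1;  a ^ n' ≡ -1 gives (-a) ^ n' ≡ 1, so a ≡ -1;
    --   a ^ (2 ^ (i + 1) n') ≡ -1 makes a ^ (2 ^ i n') a square root of -1 modulo p₀.
    only-trivial-liars : ∀ {p₀} → Prime p₀ → p₀ ℕD.∣ n → p₀ % 4 ≡ 3 → DashesCoprime →
                         ∀ c → S n c → c ≡ one ⊎ c ≡ minus-one
    only-trivial-liars _ _ _ dashes-coprime c (inj₁ aⁿ'≡1) =
      inj₁ (residue-≡ c 1<n (n'-root⇒1 dashes-coprime (+ toℕ c) (liar-power (toℕ c) n' aⁿ'≡1)))
    only-trivial-liars _ _ _ dashes-coprime c (inj₂ (zero , _ , aⁿ'≡-1)) =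
      inj₂ (residue-≡ c n-1<n (≡-mod-trans a≡-1 (≡-mod-sym n-1≡-1)))
      where
      a = + toℕ c
      [-a]ⁿ'≡1 : (- a) ^ n' ≡ 1ℤ ⟨mod n ⟩
      [-a]ⁿ'≡1 = ≡-mod-trans (≡-mod-reflexive (neg-^n' a))
                   (neg-cong-mod (liar-power (toℕ c) n' { -1ℤ} (subst (λ k → + (toℕ c ℕ.^ k) ≡ -1ℤ [mod n ]) (ℕP.*-identityˡ n') aⁿ'≡-1)))
      a≡-1 : a ≡ -1ℤ ⟨mod n ⟩
      a≡-1 = ≡-mod-trans (≡-mod-reflexive (sym (ℤP.neg-involutive a))) (neg-cong-mod (n'-root⇒1 dashes-coprime (- a) [-a]ⁿ'≡1))
    only-trivial-liars pp₀ p₀∣n p₀%4≡3 _ c (inj₂ (suc i , _ , a²ᵏ≡-1)) =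
      contradiction (≡-mod-divisor p₀∣n y²≡-1) (no-square-root-of-minus-one pp₀ p₀%4≡3 y)
      where
      y = (+ toℕ c) ^ (2 ℕ.^ i ℕ.* n')
      y²≡-1 : y * y ≡ -1ℤ ⟨mod n ⟩
      y²≡-1 = ≡-mod-trans (≡-mod-reflexive (trans (square-of-power (+ toℕ c) (2 ℕ.^ i ℕ.* n'))
                             (cong ((+ toℕ c) ^_) (sym (ℕP.*-assoc 2 (2 ℕ.^ i) n')))))
                          (liar-power (toℕ c) (2 ℕ.^ suc i ℕ.* n') a²ᵏ≡-1)

    exactly-two-liars : ∀ {p₀} → Prime p₀ → p₀ ℕD.∣ n → p₀ % 4 ≡ 3 → DashesCoprime → HasExactlyTwo (S n)
    exactly-two-liars pp₀ p₀∣n p₀%4≡3 dashes-coprime =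
      one , minus-one , one≢minus-one , liar-one , liar-minus-one ,
      only-trivial-liars pp₀ p₀∣n p₀%4≡3 dashes-coprime

    liar≡±1 : HasExactlyTwo (S n) → ∀ {a} → a < n → StrongLiar n a →
              ¬ (+ a ≡ 1ℤ ⟨mod n ⟩) → ¬ (+ a ≡ -1ℤ ⟨mod n ⟩) → ⊥
    liar≡±1 two {a} a<n liar a≢1 a≢-1 =
      no-third-element two liar-one liar-minus-one (liar-residue a<n liar) one≢minus-one
        (λ a≡one → a≢1 (≡-mod-reflexive (cong +_ (residue-value a≡one (toℕ-fromℕ< 1<n)))))
        (λ a≡-one → a≢-1 (≡-mod-trans (≡-mod-reflexive (cong +_ (residue-value a≡-one (toℕ-fromℕ< n-1<n)))) n-1≡-1))
      where
      residue-value : ∀ {c : Fin n} {m} → fromℕ< a<n ≡ c → toℕ c ≡ m → a ≡ m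
      residue-value refl toℕc≡m = trans (sym (toℕ-fromℕ< a<n)) toℕc≡m

    -- Given exactly two strong liars, every a < n with a ^ n' ≡ 1 is ≡ 1 (mod n);
    -- it cannot be ≡ -1 as (-1) ^ n' = -1 ≢ 1.
    n'-root⇒1-if-two : HasExactlyTwo (S n) → ∀ {a} → a < n → (+ a) ^ n' ≡ 1ℤ ⟨mod n ⟩ → + a ≡ 1ℤ ⟨mod n ⟩
    n'-root⇒1-if-two two {a} a<n aⁿ'≡1 with ≡-mod? n (+ a) 1ℤ
    ... | yes a≡1 = a≡1
    ... | no  a≢1 = contradiction a≢-1 (liar≡±1 two a<n liar a≢1)
      where
      liar : StrongLiar n a
      liar = inj₁ (toStatementCong (≡-mod-trans (≡-mod-reflexive (pos-^ a n')) aⁿ'≡1))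
      a≢-1 : ¬ (+ a ≡ -1ℤ ⟨mod n ⟩)
      a≢-1 a≡-1 = 1≢-1-mod 2<n (begin
        1ℤ          ≈⟨ aⁿ'≡1 ⟨
        (+ a) ^ n'  ≈⟨ ^-cong-mod n' a≡-1 ⟩
        -1ℤ ^ n'    ≡⟨ -1^n' ⟩
        -1ℤ         ∎)
        where open ≡-mod-Reasoning n

    common-prime-of-dashes : ∀ {p q r} → Prime p → n ≡ q ℕ.* p → Prime r → ¬ 2 ℕD.∣ r →
                             r ℕD.∣ dash p → r ℕD.∣ dash q → r ℕD.∣ p ℕ.∸ 1 × r ℕD.∣ n'
    common-prime-of-dashes {p} {q} {r} pp n≡qp pr 2∤r r∣p' r∣q' = r∣p-1 , r∣n'
      where
      1<q = cofactor>1 p q pp n≡qp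
      r∣p-1 = ℕD.∣-trans r∣p' (dash∣pred p (prime≥2 pp))
      r∣q-1 = ℕD.∣-trans r∣q' (dash∣pred q 1<q)
      r∣n-1 : r ℕD.∣ n ℕ.∸ 1
      r∣n-1 = subst (λ m → r ℕD.∣ m ℕ.∸ 1) (sym n≡qp)
                (∣pred-factor⇒∣pred p q (ℕP.<-trans (s≤s z≤n) (prime≥2 pp)) (ℕP.<-trans (s≤s z≤n) 1<q) r∣p-1 r∣q-1)
      r∣n' = odd-prime∣dash n 1<n pr 2∤r r∣n-1

    -- Otherwise an odd prime r
    -- divides p' and q', hence p - 1 and n - 1, hence n'.  Writing
    -- n = p ^ (e + 1) M with p ∤ M, pick c of order r modulo p ^ (e + 1) and
    -- a ≡ c (mod p ^ (e + 1)), a ≡ 1 (mod M): then a ^ n' ≡ 1 (mod n) but a ≢ 1.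
    dashes-coprime : HasExactlyTwo (S n) → DashesCoprime
    dashes-coprime two p q pp n≡qp with gcd (dash p) (dash q) ℕP.≟ 1
    ... | yes gcd≡1 = gcd≡1
    ... | no  gcd≢1 with common-odd-prime (dash p) (dash q) (dash-odd p (prime≥2 pp)) gcd≢1
    ...   | r , pr , 2∤r , r∣p' , r∣q' with common-prime-of-dashes {q = q} pp n≡qp pr 2∤r r∣p' r∣q'
    ...     | r∣p-1 , r∣n' with split-prime-power-∣ pp (divides q n≡qp) 0<n 
    ...       | e , M , n≡pᵉ⁺¹M , p∤M with element-of-prime-order e pp pr r∣p-1
    ...         | c , cʳ≡1 , c≢1 =
      contradiction (≡-mod-trans (≡-mod-sym (≡-mod-divisor p∣pᵉ⁺¹ a≡c)) a≡1[p]) c≢1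
      where
      A = p ℕ.^ suc e
      p∣pᵉ⁺¹ : p ℕD.∣ A
      p∣pᵉ⁺¹ = ℕD.m∣m*n (p ℕ.^ e)
      coprime : Coprime A M
      coprime = coprime-prime-power (suc e) pp p∤M
      instance
        _ : ℕ.NonZero (A ℕ.* M)
        _ = ℕ.>-nonZero (subst (0 <_) n≡pᵉ⁺¹M 0<n)
      solution = crt coprime c 1ℤ
      a = proj₁ solution
      a<n : a < n
      a<n = subst (a <_) (sym n≡pᵉ⁺¹M) (proj₁ (proj₂ solution))
      a≡c : + a ≡ c ⟨mod A ⟩
      a≡c = proj₁ (proj₂ (proj₂ solution))
      a≡1[M] : + a ≡ 1ℤ ⟨mod M ⟩
      a≡1[M] = proj₂ (proj₂ (proj₂ solution))
      aⁿ'≡1 : (+ a) ^ n' ≡ 1ℤ ⟨mod n ⟩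
      aⁿ'≡1 = subst (λ m → (+ a) ^ n' ≡ 1ℤ ⟨mod m ⟩) (sym n≡pᵉ⁺¹M) (≡-mod-combine coprime
                (≡-mod-trans (^-cong-mod n' a≡c)
                   (subst (λ k → c ^ k ≡ 1ℤ ⟨mod A ⟩) (sym (ℕD.m∣n⇒n≡quotient*m r∣n')) (root-of-unity-power r (ℕD.quotient r∣n') cʳ≡1)))
                (≡-mod-trans (^-cong-mod n' a≡1[M]) (≡-mod-reflexive (ℤP.^-zeroˡ n'))))
      a≡1[p] : + a ≡ 1ℤ ⟨mod p ⟩
      a≡1[p] = ≡-mod-divisor (ℕD.∣-trans p∣pᵉ⁺¹ (divides M (trans n≡pᵉ⁺¹M (ℕP.*-comm A M))))
                 (n'-root⇒1-if-two two a<n aⁿ'≡1)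

    module _ (all-1-mod-4 : ∀ p → Prime p → p ℕD.∣ n → p % 4 ≡ 1) where

      n≡1-mod-4 : + n ≡ 1ℤ ⟨mod 4 ⟩
      n≡1-mod-4 = prime-power-induction (λ N → N ℕD.∣ n → + N ≡ 1ℤ ⟨mod 4 ⟩) (λ _ → ≡-mod-refl 1ℤ) step n 0<n ℕD.∣-refl
        where
        step : ∀ {p} e M → Prime p → ¬ p ℕD.∣ M → (M ℕD.∣ n → + M ≡ 1ℤ ⟨mod 4 ⟩) →
               p ℕ.^ suc e ℕ.* M ℕD.∣ n → + (p ℕ.^ suc e ℕ.* M) ≡ 1ℤ ⟨mod 4 ⟩
        step {p} e M pp _ M≡1 N∣n = begin
          + (p ℕ.^ suc e ℕ.* M)      ≡⟨ trans (ℤP.pos-* (p ℕ.^ suc e) M) (cong (_* + M) (pos-^ p (suc e))) ⟩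
          (+ p) ^ suc e * + M        ≈⟨ *-cong-mod (^-cong-mod (suc e) (%4≡1⇒≡1-mod-4 {p} (all-1-mod-4 p pp p∣n)))
                                                   (M≡1 (ℕD.∣-trans (ℕD.n∣m*n (p ℕ.^ suc e)) N∣n)) ⟩
          1ℤ ^ suc e * 1ℤ            ≡⟨ trans (ℤP.*-identityʳ (1ℤ ^ suc e)) (ℤP.^-zeroˡ (suc e)) ⟩
          1ℤ                         ∎
          where
          open ≡-mod-Reasoning 4
          p∣n = ℕD.∣-trans (ℕD.∣-trans (ℕD.m∣m*n (p ℕ.^ e)) (ℕD.m∣m*n M)) N∣n

      -- And -1 is a square modulo n: take a square root modulo each prime power
      -- p ^ (e + 1) ∥ n and glue them by the Chinese remainder theorem.
      minus-one-is-square : Σ ℤ λ t → t * t ≡ -1ℤ ⟨mod n ⟩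
      minus-one-is-square = prime-power-induction Square (λ _ → 0ℤ , ≡-mod-1 _ _) step n 0<n ℕD.∣-refl
        where
        Square : ℕ → Set
        Square N = N ℕD.∣ n → Σ ℤ λ t → t * t ≡ -1ℤ ⟨mod N ⟩
        step : ∀ {p} e M → Prime p → ¬ p ℕD.∣ M → Square M → Square (p ℕ.^ suc e ℕ.* M)
        step {p} e M pp p∤M square[M] N∣n =
          + a , ≡-mod-combine coprime (≡-mod-trans (*-cong-mod a≡t a≡t) (proj₂ root[pᵉ⁺¹]))
                                      (≡-mod-trans (*-cong-mod a≡s a≡s) (proj₂ root[M]))
          where
          p∣n = ℕD.∣-trans (ℕD.∣-trans (ℕD.m∣m*n (p ℕ.^ e)) (ℕD.m∣m*n M)) N∣n
          root[M] = square[M] (ℕD.∣-trans (ℕD.n∣m*n (p ℕ.^ suc e)) N∣n)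
          root[pᵉ⁺¹] = square-root-of-minus-one e pp (all-1-mod-4 p pp p∣n)
          coprime = coprime-prime-power (suc e) pp p∤M
          instance
            _ : ℕ.NonZero (p ℕ.^ suc e ℕ.* M)
            _ = ℕ.≢-nonZero λ N≡0 → ℕP.<⇒≢ 0<n (sym (ℕD.0∣⇒≡0 (subst (ℕD._∣ n) N≡0 N∣n)))
          solution = crt coprime (proj₁ root[pᵉ⁺¹]) (proj₁ root[M])
          a = proj₁ solution
          a≡t = proj₁ (proj₂ (proj₂ solution))
          a≡s = proj₂ (proj₂ (proj₂ solution))

      -- A square root a < n of -1 is a strong liar (with i = 1, allowed as
      -- 4 ∣ n - 1) and is not ±1, whose squares are 1; so there are more than
      -- two strong liars.
      more-than-two-liars : ¬ HasExactlyTwo (S n)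
      more-than-two-liars two = liar≡±1 two a<n liar (square≢-1 1ℤ refl) (square≢-1 -1ℤ refl)
        where
        t = proj₁ minus-one-is-square
        reduced = reduce t n {{ℕ.>-nonZero 0<n}}
        a = proj₁ reduced
        a<n = proj₁ (proj₂ reduced)
        a²≡-1 : + a * + a ≡ -1ℤ ⟨mod n ⟩
        a²≡-1 = ≡-mod-trans (*-cong-mod (proj₂ (proj₂ reduced)) (proj₂ (proj₂ reduced))) (proj₂ minus-one-is-square)
        square≢-1 : ∀ u → u * u ≡ 1ℤ → ¬ (+ a ≡ u ⟨mod n ⟩)
        square≢-1 u u²≡1 a≡u = 1≢-1-mod 2<n
          (≡-mod-trans (≡-mod-reflexive (sym u²≡1)) (≡-mod-trans (*-cong-mod (≡-mod-sym a≡u) (≡-mod-sym a≡u)) a²≡-1))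
        4∣n-1 : 4 ℕD.∣ n ℕ.∸ 1
        4∣n-1 = subst (4 ℕD.∣_) (cong ℤ.∣_∣ (trans (ℤP.m-n≡m⊖n n 1) (ℤP.⊖-≥ 0<n))) (∣ℤ⇒∣ (divides-difference n≡1-mod-4))
        liar : StrongLiar n a
        liar = inj₂ (1 , val2>1 n 1<n 4∣n-1 , toStatementCong (begin
          + (a ℕ.^ (2 ℕ.* n'))    ≡⟨ pos-^ a (2 ℕ.* n') ⟩
          (+ a) ^ (2 ℕ.* n')      ≡⟨ ^-* (+ a) 2 n' ⟩
          ((+ a) ^ 2) ^ n'        ≡⟨ cong (λ x → (+ a * x) ^ n') (ℤP.*-identityʳ (+ a)) ⟩
          (+ a * + a) ^ n'        ≈⟨ ^-cong-mod n' a²≡-1 ⟩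
          -1ℤ ^ n'                ≡⟨ -1^n' ⟩
          -1ℤ                     ∎))
          where open ≡-mod-Reasoning n

    -- Exactly two strong liars force condition (1): decide whether a prime
    -- p ≤ n with p ∣ n and p ≡ 3 (mod 4) exists; if not, every prime divisor
    -- of the odd number n is ≡ 1 (mod 4) and there are more than two liars.
    prime-3-mod-4 : HasExactlyTwo (S n) → Σ ℕ λ p → Prime p × p ℕD.∣ n × p % 4 ≡ 3
    prime-3-mod-4 two with any? {P = Candidate} (λ i → prime? (toℕ i) ×-dec (toℕ i ℕD.∣? n) ×-dec (toℕ i % 4 ℕP.≟ 3))
      where
      Candidate : Fin (suc n) → Set
      Candidate i = Prime (toℕ i) × toℕ i ℕD.∣ n × toℕ i % 4 ≡ 3
    ... | yes (i , candidate) = toℕ i , candidate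
    ... | no  none = contradiction two (more-than-two-liars all-1-mod-4)
      where
      all-1-mod-4 : ∀ p → Prime p → p ℕD.∣ n → p % 4 ≡ 1
      all-1-mod-4 p pp p∣n with odd-mod-4 p (λ 2∣p → 2∤n (ℕD.∣-trans 2∣p p∣n))
      ... | inj₁ p%4≡1 = p%4≡1
      ... | inj₂ p%4≡3 = contradiction (fromℕ< p<1+n , subst (λ m → Prime m × m ℕD.∣ n × m % 4 ≡ 3)
                                                        (sym (toℕ-fromℕ< p<1+n)) (pp , p∣n , p%4≡3)) none
        where
        p<1+n : p < suc n
        p<1+n = s≤s (ℕD.∣⇒≤ {{ℕ.>-nonZero 0<n}} p∣n)

open import Defs
open import Data.Nat.Base using (ℕ; _*_; _%_)
open import Data.Nat.Divisibility using (_∣_)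
open import Data.Nat.Primality using (Prime; Composite)
open import Data.Nat.GCD using (gcd)
open import Data.Product using (Σ; _×_; _,_)
open import Function.Bundles using (_⇔_; mk⇔)
open import Relation.Nullary using (¬_)
open import Relation.Binary.PropositionalEquality using (_≡_)

proposition2p4 : (n : ℕ) → ¬ (2 ∣ n) → Composite n →
    HasExactlyTwo (S n) ⇔
      ((Σ ℕ λ p → Prime p × p ∣ n × p % 4 ≡ 3)
        × ((p q : ℕ) → Prime p → n ≡ q * p → gcd (dash p) (dash q) ≡ 1))
proposition2p4 n 2∤n composite = mk⇔
  (λ two → prime-3-mod-4 two , dashes-coprime two)
  (λ { ((p , pp , p∣n , p%4≡3) , condition₂) → exactly-two-liars pp p∣n p%4≡3 condition₂ })
  where open StrongLiars.OddComposite n 2∤n composite
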